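{- For all nonnegative integers $n,k$ with $0\le k\le n$, \[ \sum_{\pi \in \mathfrak{S}_{n}^{k}}\beta^{{\rm rlmin}(\pi)}q^{{\rm maj}(\pi)} = \sum_{\pi \in \mathfrak{S}_{n}^{k}}\beta^{{\rm rlmin}(\pi)}q^{{\rm inv}(\pi)}={n\brack k}_q [k+1]_{\beta,q}[k+2]_{\beta,q}\cdots [n]_{\beta,q}, \] where $\beta,q$ are indeterminates.
   Context: A partial permutation (Laguerre word) in $\mathfrak{S}_n^k$ is a word $\pi=\pi_1\pi_2\cdots\pi_n$ of length $n$ in which exactly $k$ letters are a hole symbol $\lozenge$ and the other $n-k$ letters are distinct elements of $[n]=\{1,\dots,n\}$. Letters are ordered $1<2<\cdots<n<\lozenge$. Let $S_\pi\subseteq[n]$ be the set of numerical letters of $\pi$ and $\overline S_\pi=[n]\setminus S_\pi$. For disjoint sets $A,B$ of integers, ${\rm inv}(A,B)=|\{(a,b)\in A\times B: a>b\}|$. For $i\in[n]$, ${\rm inv}^{\Box,i}(\pi)=|\{j: 1\le j<i,\ \pi_j>\pi_i\}|$, and ${\rm inv}_0(\pi)=\sum_{i=1}^n {\rm inv}^{\Box,i}(\pi)$. The descent set is ${\rm Des}(\pi)=\{i\in[n-1]:\pi_i>\pi_{i+1}\}$ and ${\rm maj}_0(\pi)=\sum_{i\in{\rm Des}(\pi)} i$. Define ${\rm inv}(\pi)={\rm inv}_0(\pi)+{\rm inv}(S_\pi,\overline S_\pi)$ and ${\rm maj}(\pi)={\rm maj}_0(\pi)+{\rm inv}(S_\pi,\overline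 S_\pi)$. A numerical letter $\pi_i\in[n]$ is a right-to-left minimum if every element of $\{1,\dots,\pi_i-1\}$ occurs in $\pi$ at a position before $i$; ${\rm rlmin}(\pi)$ is the number of right-to-left minima. For $m\ge1$, $[m]_{\beta,q}=\beta-1+1+q+\cdots+q^{m-1}=\beta+q+q^2+\cdots+q^{m-1}$; $[m]_q=1+q+\cdots+q^{m-1}$, $[m]_q!=[1]_q\cdots[m]_q$, $[0]_q!=1$, and ${n\brack k}_q=\frac{[n]_q!}{[k]_q![n-k]_q!}$. The empty product (when $k=n$) is $1$. -}

module Defs where

open import Data.Nat using (ℕ; zero; suc; _+_; _*_; _∸_; _^_; _<ᵇ_; _≡ᵇ_; NonZero)
open import Data.Nat.Properties using (m*n≢0)
open import Data.Nat.ListAction using (sum; product)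
open import Data.Nat.DivMod using (_/_)
open import Data.Bool using (Bool; true; false; if_then_else_; _∧_; not)
open import Data.List using (List; []; _∷_; [_]; _++_; map; concatMap; filter; upTo; applyUpTo; catMaybes; foldr)
open import Data.Bool.ListAction using (all; any)
open import Data.Maybe using (Maybe; just; nothing)
open import Relation.Nullary.Decidable using (Dec)
open import Data.Bool.Properties using (T?)

-- A letter: nothing is the hole symbol ◊, just a is the numerical letter a.
Letter : Set
Letter = Maybe ℕ

Word : Set
Word = List Letter

-- strict comparison x > y for the order 1 < 2 < ... < n < ◊
_>ᴸ_ : Letter → Letter → Bool
nothing >ᴸ nothing = false
nothing >ᴸ just _  = true
just _  >ᴸ nothing = false
just a  >ᴸ just b  = b <ᵇ a

range1 : ℕ → List ℕ
range1 n = applyUpTo suc n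

letters : ℕ → List Letter
letters n = nothing ∷ map just (range1 n)

allWords : ℕ → ℕ → List Word
allWords n zero      = [] ∷ []
allWords n (suc len) = concatMap (λ x → map (x ∷_) (allWords n len)) (letters n)

elemℕ : ℕ → List ℕ → Bool
elemℕ a xs = any (λ b → a ≡ᵇ b) xs

noDup : List ℕ → Bool
noDup []       = true
noDup (x ∷ xs) = not (elemℕ x xs) ∧ noDup xs

isHole : Letter → Bool
isHole nothing  = true
isHole (just _) = false

countB : {A : Set} → (A → Bool) → List A → ℕ
countB p []       = 0
countB p (x ∷ xs) = (if p x then 1 else 0) + countB p xs

holes : Word → ℕ
holes w = countB isHole w

numerals : Word → List ℕ
numerals = catMaybes

-- 𝔖_n^k : words of length n with exactly k holes, numerical letters distinct
-- elements of [n]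
PartialPerms : ℕ → ℕ → List Word
PartialPerms n k =
  filter (λ w → T? ((holes w ≡ᵇ k) ∧ noDup (numerals w))) (allWords n n)

invSets : ℕ → Word → ℕ
invSets n w =
  sum (map (λ a → countB (λ b → not (elemℕ b (numerals w)) ∧ (b <ᵇ a)) (range1 n))
           (numerals w))

inv0Aux : Word → Word → ℕ
inv0Aux pre []       = 0
inv0Aux pre (x ∷ xs) = countB (λ y → y >ᴸ x) pre + inv0Aux (pre ++ [ x ]) xs

inv0 : Word → ℕ
inv0 w = inv0Aux [] w

-- maj_0 : sum of descent positions (positions 1-based)
maj0Aux : ℕ → Word → ℕ
maj0Aux i []           = 0
maj0Aux i (x ∷ [])     = 0
maj0Aux i (x ∷ y ∷ xs) = (if x >ᴸ y then i else 0) + maj0Aux (suc i) (y ∷ xs)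

maj0 : Word → ℕ
maj0 w = maj0Aux 1 w

inv : ℕ → Word → ℕ
inv n w = inv0 w + invSets n w

maj : ℕ → Word → ℕ
maj n w = maj0 w + invSets n w

rlminAux : Word → Word → ℕ
rlminAux pre []              = 0
rlminAux pre (nothing ∷ xs)  = rlminAux (pre ++ [ nothing ]) xs
rlminAux pre (just a ∷ xs)   =
  (if all (λ b → elemℕ b (numerals pre)) (range1 (a ∸ 1)) then 1 else 0)
  + rlminAux (pre ++ [ just a ]) xs

rlmin : Word → ℕ
rlmin w = rlminAux [] w

-- generating functions evaluated at natural numbers β, q
sumRlminMaj : ℕ → ℕ → ℕ → ℕ → ℕ
sumRlminMaj n k β q = sum (map (λ π → β ^ rlmin π * q ^ maj n π) (PartialPerms n k))

sumRlminInv : ℕ → ℕ → ℕ → ℕ → ℕ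
sumRlminInv n k β q = sum (map (λ π → β ^ rlmin π * q ^ inv n π) (PartialPerms n k))

qint : ℕ → ℕ → ℕ
qint m q = sum (map (q ^_) (upTo m))

qfact : ℕ → ℕ → ℕ
qfact zero    q = 1
qfact (suc m) q = qint (suc m) q * qfact m q

qfact-nz : ∀ m q → NonZero (qfact m q)
qfact-nz zero    q = _
qfact-nz (suc m) q = m*n≢0 (qint (suc m) q) (qfact m q) {{_}} {{qfact-nz m q}}

-- q-binomial [n k]_q = [n]_q! / ([k]_q! [n-k]_q!)  (exact division in ℕ)
qbinom : ℕ → ℕ → ℕ → ℕ
qbinom n k q = _/_ (qfact n q) (qfact k q * qfact (n ∸ k) q)
  {{m*n≢0 (qfact k q) (qfact (n ∸ k) q) {{qfact-nz k q}} {{qfact-nz (n ∸ k) q}}}}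

βqint : ℕ → ℕ → ℕ → ℕ
βqint m β q = β + sum (map (λ i → q ^ suc i) (upTo (m ∸ 1)))

βqprod : ℕ → ℕ → ℕ → ℕ → ℕ
βqprod n k β q = product (map (λ m → βqint m β q) (applyUpTo (λ i → suc (k + i)) (n ∸ k)))

-- Both sums are evaluated over all words of length L over {1, …, N, ◊} with k holes and
-- distinct numerals, where they equal qbin L k · [N]_{β,q} [N-1]_{β,q} ⋯ [N-L+k+1]_{β,q}.
--
-- inv: append the last letter. A hole changes nothing. A new value a adds to inv the k holes
-- before it and the missing values below a, and it is a right-to-left minimum iff no smaller
-- value is missing; summing over the c missing values gives q^k [c]_{β,q}, and the q-Pascal
-- rule closes the induction on L.
--
-- maj: insert the largest value N+1 into a word over [N] (Carlitz). Since ◊ exceeds N+1, the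
-- words ending in a hole are set aside: they are words with one hole fewer followed by ◊,
-- which changes no statistic. Among the others, the insertion slots raise maj₀ by 0, 1, …, L,
-- every slot raises inv(S, S̄) by the number c of missing values, and N+1 is a right-to-left
-- minimum only in the last slot and only when c = 0. Induction on N gives the same closed form.
module Submission where

open import Defs
open import Data.Nat using (ℕ; zero; suc; _+_; _*_; _∸_; _^_; _<ᵇ_; _≡ᵇ_; _≤_; _<_; _≤?_; z≤n; s≤s; NonZero)
open import Data.Nat.Properties
open import Data.Nat.ListAction using (sum; product)
open import Data.Nat.ListAction.Properties using (sum-++; product-++)
open import Data.Nat.DivMod using (_/_; m*n/n≡m)
import Algebra.Properties.CommutativeSemigroup *-commutativeSemigroup as *-CS
import Algebra.Properties.CommutativeSemigroup +-commutativeSemigroup as +-CS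
open import Data.Bool using (Bool; true; false; if_then_else_; _∧_; _∨_; not)
open import Data.Bool.Properties using (T?; if-eta; ∧-zeroʳ; ∧-identityʳ; ∧-assoc; ∨-identityʳ; ∨-assoc)
open import Data.Bool.ListAction using (all)
open import Data.List using (List; []; _∷_; [_]; _++_; _∷ʳ_; map; concatMap; filter; upTo; applyUpTo; length; take)
open import Data.List.Properties using (map-++; map-∘; map-cong; catMaybes-++; ++-assoc; ++-identityʳ; length-++; applyUpTo-∷ʳ; length-applyUpTo; map-upTo; take-all)
open import Data.List.Relation.Unary.All using (All; []; _∷_)
open import Data.List.Reverse using (Reverse; []; _∶_∶ʳ_; reverseView)
import Data.List.Relation.Unary.All as All
import Data.List.Relation.Unary.All.Properties as All
open import Data.Product using (_×_; _,_; proj₁; proj₂)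
open import Data.Unit using (⊤; tt)
open import Data.Sum using (_⊎_; inj₁; inj₂)
open import Data.Maybe using (just; nothing)
open import Function using (_∘_; _⟨_⟩_)
open import Relation.Nullary using (yes; no)
open import Relation.Binary.PropositionalEquality hiding ([_])
open import Data.Nat.Tactic.RingSolver using (solve-∀)

cong₃ : {A B C D : Set} (f : A → B → C → D) {x x′ : A} {y y′ : B} {z z′ : C} →
        x ≡ x′ → y ≡ y′ → z ≡ z′ → f x y z ≡ f x′ y′ z′
cong₃ f refl refl refl = refl

∑ : {A : Set} → List A → (A → ℕ) → ℕ
∑ xs f = sum (map f xs)

syntax ∑ xs (λ x → e) = ∑[ x ∈ xs ] e

module _ {A : Set} where

  ∑-++ : (xs ys : List A) (f : A → ℕ) → ∑ (xs ++ ys) f ≡ ∑ xs f + ∑ ys f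
  ∑-++ xs ys f = trans (cong sum (map-++ f xs ys)) (sum-++ (map f xs) (map f ys))

  ∑-∷ʳ : (xs : List A) (x : A) (f : A → ℕ) → ∑ (xs ∷ʳ x) f ≡ ∑ xs f + f x
  ∑-∷ʳ xs x f = trans (∑-++ xs [ x ] f) (cong (∑ xs f +_) (+-identityʳ (f x)))

  ∑-cong : (xs : List A) {f g : A → ℕ} → (∀ x → f x ≡ g x) → ∑ xs f ≡ ∑ xs g
  ∑-cong xs f≗g = cong sum (map-cong f≗g xs)

  ∑-cong-All : {P : A → Set} {xs : List A} {f g : A → ℕ} →
               All P xs → (∀ x → P x → f x ≡ g x) → ∑ xs f ≡ ∑ xs g
  ∑-cong-All []                 f≗g = refl
  ∑-cong-All (_∷_ {x} px pxs) f≗g = cong₂ _+_ (f≗g x px) (∑-cong-All pxs f≗g)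

  ∑-zero : (xs : List A) → ∑[ x ∈ xs ] 0 ≡ 0
  ∑-zero []       = refl
  ∑-zero (x ∷ xs) = ∑-zero xs

  ∑-+ : (xs : List A) (f g : A → ℕ) → ∑[ x ∈ xs ] (f x + g x) ≡ ∑ xs f + ∑ xs g
  ∑-+ []       f g = refl
  ∑-+ (x ∷ xs) f g = trans (cong (f x + g x +_) (∑-+ xs f g)) (interchange (f x) (g x) _ _)
    where interchange : ∀ a b c d → a + b + (c + d) ≡ a + c + (b + d)
          interchange = solve-∀

  ∑-*ˡ : (xs : List A) (c : ℕ) (f : A → ℕ) → ∑[ x ∈ xs ] (c * f x) ≡ c * ∑ xs f
  ∑-*ˡ []       c f = sym (*-zeroʳ c)
  ∑-*ˡ (x ∷ xs) c f = trans (cong (c * f x +_) (∑-*ˡ xs c f)) (sym (*-distribˡ-+ c (f x) _))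

  ∑-filter : (v : A → Bool) (xs : List A) (f : A → ℕ) →
             sum (map f (filter (λ x → T? (v x)) xs)) ≡ ∑[ x ∈ xs ] (if v x then f x else 0)
  ∑-filter v []       f = refl
  ∑-filter v (x ∷ xs) f with v x
  ... | true  = cong (f x +_) (∑-filter v xs f)
  ... | false = ∑-filter v xs f

∑-map : {A B : Set} (g : A → B) (xs : List A) (f : B → ℕ) → ∑ (map g xs) f ≡ ∑[ x ∈ xs ] f (g x)
∑-map g xs f = cong sum (sym (map-∘ xs))

∑-concatMap : {A B : Set} (g : A → List B) (xs : List A) (f : B → ℕ) →
              ∑ (concatMap g xs) f ≡ ∑[ x ∈ xs ] ∑ (g x) f
∑-concatMap g []       f = refl
∑-concatMap g (x ∷ xs) f = trans (∑-++ (g x) (concatMap g xs) f) (cong (∑ (g x) f +_) (∑-concatMap g xs f))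

∑-upTo-sucʳ : (m : ℕ) (f : ℕ → ℕ) → ∑ (upTo (suc m)) f ≡ ∑ (upTo m) f + f m
∑-upTo-sucʳ m f = trans (cong (λ xs → ∑ xs f) (sym (applyUpTo-∷ʳ (λ i → i) m))) (∑-∷ʳ (upTo m) m f)

∑-upTo-sucˡ : (m : ℕ) (f : ℕ → ℕ) → ∑ (upTo (suc m)) f ≡ f 0 + ∑[ i ∈ upTo m ] f (suc i)
∑-upTo-sucˡ m f = cong (f 0 +_) (trans (cong (λ xs → ∑ xs f) (sym (map-upTo suc m))) (∑-map suc (upTo m) f))

ind : Bool → ℕ
ind b = if b then 1 else 0

module _ {A : Set} where

  countB-++ : (p : A → Bool) (xs ys : List A) → countB p (xs ++ ys) ≡ countB p xs + countB p ys
  countB-++ p []       ys = refl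
  countB-++ p (x ∷ xs) ys = trans (cong (ind (p x) +_) (countB-++ p xs ys)) (sym (+-assoc (ind (p x)) _ _))

  countB-∷ʳ : (p : A → Bool) (xs : List A) (x : A) → countB p (xs ∷ʳ x) ≡ countB p xs + ind (p x)
  countB-∷ʳ p xs x = trans (countB-++ p xs [ x ]) (cong (countB p xs +_) (+-identityʳ _))

  countB-cong : (xs : List A) {p r : A → Bool} → (∀ x → p x ≡ r x) → countB p xs ≡ countB r xs
  countB-cong []       p≗r = refl
  countB-cong (x ∷ xs) p≗r = cong₂ _+_ (cong ind (p≗r x)) (countB-cong xs p≗r)

  countB-cong-All : {P : A → Set} {xs : List A} {p r : A → Bool} →
                    All P xs → (∀ x → P x → p x ≡ r x) → countB p xs ≡ countB r xs
  countB-cong-All []               p≗r = refl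
  countB-cong-All (_∷_ {x} px pxs) p≗r = cong₂ _+_ (cong ind (p≗r x px)) (countB-cong-All pxs p≗r)

  countB-false : (xs : List A) → countB (λ _ → false) xs ≡ 0
  countB-false []       = refl
  countB-false (x ∷ xs) = countB-false xs

  countB-not+countB : (p : A → Bool) (xs : List A) → countB (λ x → not (p x)) xs + countB p xs ≡ length xs
  countB-not+countB p []       = refl
  countB-not+countB p (x ∷ xs) with p x
  ... | true  = trans (+-suc _ _) (cong suc (countB-not+countB p xs))
  ... | false = cong suc (countB-not+countB p xs)

  countB-∨ : (p r : A → Bool) (xs : List A) → (∀ x → (p x ∧ r x) ≡ false) →
             countB (λ x → p x ∨ r x) xs ≡ countB p xs + countB r xs
  countB-∨ p r []       disjoint = refl
  countB-∨ p r (x ∷ xs) disjoint with p x | r x | disjoint x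
  ... | true  | false | _ = cong suc (countB-∨ p r xs disjoint)
  ... | false | true  | _ = trans (cong suc (countB-∨ p r xs disjoint)) (sym (+-suc _ _))
  ... | false | false | _ = countB-∨ p r xs disjoint

  countB-split : (g r : A → Bool) (xs : List A) →
                 countB g xs ≡ countB (λ x → g x ∧ not (r x)) xs + countB (λ x → g x ∧ r x) xs
  countB-split g r []       = refl
  countB-split g r (x ∷ xs) with g x | r x
  ... | true  | true  = trans (cong suc (countB-split g r xs)) (sym (+-suc _ _))
  ... | true  | false = cong suc (countB-split g r xs)
  ... | false | _     = countB-split g r xs

  countB≡∑ind : (p : A → Bool) (xs : List A) → countB p xs ≡ ∑[ x ∈ xs ] ind (p x)
  countB≡∑ind p []       = refl
  countB≡∑ind p (x ∷ xs) = cong (ind (p x) +_) (countB≡∑ind p xs)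

all≡countB-not≡ᵇ0 : {A : Set} (p : A → Bool) (xs : List A) → all p xs ≡ (countB (λ x → not (p x)) xs ≡ᵇ 0)
all≡countB-not≡ᵇ0 p []       = refl
all≡countB-not≡ᵇ0 p (x ∷ xs) with p x
... | true  = all≡countB-not≡ᵇ0 p xs
... | false = refl

all-cong-All : {A : Set} {P : A → Set} {xs : List A} {p r : A → Bool} → All P xs → (∀ x → P x → p x ≡ r x) → all p xs ≡ all r xs
all-cong-All []               p≗r = refl
all-cong-All (_∷_ {x} px pxs) p≗r = cong₂ _∧_ (p≗r x px) (all-cong-All pxs p≗r)

∧-true : ∀ x y → (x ∧ y) ≡ true → x ≡ true × y ≡ true
∧-true true true _ = refl , refl

all-∷ʳ : {A : Set} (P : A → Bool) (xs : List A) (x : A) → all P (xs ∷ʳ x) ≡ all P xs ∧ P x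
all-∷ʳ P []       x = ∧-identityʳ (P x)
all-∷ʳ P (y ∷ xs) x = trans (cong (P y ∧_) (all-∷ʳ P xs x)) (sym (∧-assoc (P y) _ _))

≡ᵇ-refl : ∀ n → (n ≡ᵇ n) ≡ true
≡ᵇ-refl zero    = refl
≡ᵇ-refl (suc n) = ≡ᵇ-refl n

≡ᵇ-sym : ∀ m n → (m ≡ᵇ n) ≡ (n ≡ᵇ m)
≡ᵇ-sym zero    zero    = refl
≡ᵇ-sym zero    (suc n) = refl
≡ᵇ-sym (suc m) zero    = refl
≡ᵇ-sym (suc m) (suc n) = ≡ᵇ-sym m n

≡ᵇ-true⇒≡ : ∀ m n → (m ≡ᵇ n) ≡ true → m ≡ n
≡ᵇ-true⇒≡ zero    zero    _ = refl
≡ᵇ-true⇒≡ (suc m) (suc n) e = cong suc (≡ᵇ-true⇒≡ m n e)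

<⇒≢ᵇ : ∀ {m n} → m < n → (m ≡ᵇ n) ≡ false
<⇒≢ᵇ {zero}  {suc n} _         = refl
<⇒≢ᵇ {suc m} {suc n} (s≤s m<n) = <⇒≢ᵇ m<n

>⇒≢ᵇ : ∀ {m n} → n < m → (m ≡ᵇ n) ≡ false
>⇒≢ᵇ {m} {n} n<m = trans (≡ᵇ-sym m n) (<⇒≢ᵇ n<m)

<⇒<ᵇ-true : ∀ {m n} → m < n → (m <ᵇ n) ≡ true
<⇒<ᵇ-true {zero}  {suc n} _         = refl
<⇒<ᵇ-true {suc m} {suc n} (s≤s m<n) = <⇒<ᵇ-true m<n

≥⇒<ᵇ-false : ∀ {m n} → n ≤ m → (m <ᵇ n) ≡ false
≥⇒<ᵇ-false {m}     {zero}  _         = refl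
≥⇒<ᵇ-false {suc m} {suc n} (s≤s n≤m) = ≥⇒<ᵇ-false n≤m

<ᵇ⇒≢ᵇ : ∀ m n → (m <ᵇ n) ≡ true → (m ≡ᵇ n) ≡ false
<ᵇ⇒≢ᵇ zero    (suc n) _ = refl
<ᵇ⇒≢ᵇ (suc m) (suc n) e = <ᵇ⇒≢ᵇ m n e

-- q-integers, q-binomials and the closed forms
module QNumbers (β q : ℕ) where

  qnum : ℕ → ℕ
  qnum zero    = 0
  qnum (suc m) = 1 + q * qnum m

  -- Unlike βqint, βqnum 0 = 0, so that βqfall N r below vanishes once r > N.
  βqnum : ℕ → ℕ
  βqnum zero    = 0
  βqnum (suc m) = β + q * qnum m

  βif : Bool → ℕ
  βif b = if b then β else 1

  q^-+ : ∀ m n → q ^ (m + n) ≡ q ^ m * q ^ n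
  q^-+ = ^-distribˡ-+-* q

  qnum-+ : ∀ a b → qnum (a + b) ≡ qnum a + q ^ a * qnum b
  qnum-+ zero    b = sym (+-identityʳ (qnum b))
  qnum-+ (suc a) b = trans (cong (λ x → 1 + q * x) (qnum-+ a b)) (distrib q (qnum a) (q ^ a) (qnum b))
    where distrib : ∀ q x y z → 1 + q * (x + y * z) ≡ 1 + q * x + q * y * z
          distrib = solve-∀

  qnum-suc : ∀ m → qnum (suc m) ≡ qnum m + q ^ m
  qnum-suc m = begin
    qnum (suc m)                ≡⟨ cong qnum (+-comm 1 m) ⟩
    qnum (m + 1)                ≡⟨ qnum-+ m 1 ⟩
    qnum m + q ^ m * (1 + q * 0) ≡⟨ cong (λ x → qnum m + q ^ m * suc x) (*-zeroʳ q) ⟩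
    qnum m + q ^ m * 1          ≡⟨ cong (qnum m +_) (*-identityʳ (q ^ m)) ⟩
    qnum m + q ^ m              ∎
    where open ≡-Reasoning

  βqnum-split : ∀ c r → βqnum (suc (c + r)) ≡ βqnum c + q ^ c * (βif (c ≡ᵇ 0) + q * qnum r)
  βqnum-split zero    r = sym (+-identityʳ _)
  βqnum-split (suc c) r = begin
    β + q * qnum (suc c + r)                     ≡⟨ cong (λ x → β + q * x) (qnum-+ (suc c) r) ⟩
    β + q * (qnum (suc c) + q ^ suc c * qnum r)  ≡⟨ cong (λ x → β + q * (x + q ^ suc c * qnum r)) (qnum-suc c) ⟩
    β + q * (qnum c + q ^ c + q * q ^ c * qnum r) ≡⟨ distrib β q (qnum c) (q ^ c) (qnum r) ⟩
    β + q * qnum c + q * q ^ c * (1 + q * qnum r) ∎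
    where open ≡-Reasoning
          distrib : ∀ β q x y z → β + q * (x + y + q * y * z) ≡ β + q * x + q * y * (1 + q * z)
          distrib = solve-∀

  βqnum-suc : ∀ c → βqnum (suc c) ≡ βqnum c + βif (c ≡ᵇ 0) * q ^ c
  βqnum-suc c = begin
    βqnum (suc c)                              ≡⟨ cong (βqnum ∘ suc) (sym (+-identityʳ c)) ⟩
    βqnum (suc (c + 0))                        ≡⟨ βqnum-split c 0 ⟩
    βqnum c + q ^ c * (βif (c ≡ᵇ 0) + q * 0)  ≡⟨ cong (λ x → βqnum c + q ^ c * (βif (c ≡ᵇ 0) + x)) (*-zeroʳ q) ⟩
    βqnum c + q ^ c * (βif (c ≡ᵇ 0) + 0)      ≡⟨ cong (λ x → βqnum c + q ^ c * x) (+-identityʳ _) ⟩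
    βqnum c + q ^ c * βif (c ≡ᵇ 0)            ≡⟨ cong (βqnum c +_) (*-comm (q ^ c) _) ⟩
    βqnum c + βif (c ≡ᵇ 0) * q ^ c            ∎
    where open ≡-Reasoning

  qfac : ℕ → ℕ
  qfac zero    = 1
  qfac (suc m) = qnum (suc m) * qfac m

  qfac-nonZero : ∀ m → NonZero (qfac m)
  qfac-nonZero zero    = _
  qfac-nonZero (suc m) = m*n≢0 (qnum (suc m)) (qfac m) {{_}} {{qfac-nonZero m}}

  qfac*qfac-nonZero : ∀ m n → NonZero (qfac m * qfac n)
  qfac*qfac-nonZero m n = m*n≢0 (qfac m) (qfac n) {{qfac-nonZero m}} {{qfac-nonZero n}}

  qbin : ℕ → ℕ → ℕ
  qbin zero    zero    = 1
  qbin zero    (suc k) = 0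
  qbin (suc n) zero    = 1
  qbin (suc n) (suc k) = qbin n k + q ^ suc k * qbin n (suc k)

  qbin-zero : ∀ n → qbin n 0 ≡ 1
  qbin-zero zero    = refl
  qbin-zero (suc n) = refl

  qbin-< : ∀ {n k} → n < k → qbin n k ≡ 0
  qbin-< {zero}  {suc k} _         = refl
  qbin-< {suc n} {suc k} (s≤s n<k) =
    trans (cong₂ (λ a b → a + q ^ suc k * b) (qbin-< n<k) (qbin-< (m<n⇒m<1+n n<k))) (*-zeroʳ (q ^ suc k))

  qbin-diag : ∀ n → qbin n n ≡ 1
  qbin-diag zero    = refl
  qbin-diag (suc n) =
    trans (cong₂ (λ a b → a + q ^ suc n * b) (qbin-diag n) (qbin-< (n<1+n n))) (cong suc (*-zeroʳ (q ^ suc n)))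

  qbin-qfac : ∀ n k r → k + r ≡ n → qbin n k * (qfac k * qfac r) ≡ qfac n
  qbin-qfac zero    zero    zero    refl = refl
  qbin-qfac (suc n) zero    r       refl = trans (+-identityʳ _) (+-identityʳ _)
  qbin-qfac (suc n) (suc k) zero    refl rewrite +-identityʳ k =
    trans (cong (_* (qfac (suc k) * 1)) (qbin-diag (suc k))) (trans (*-identityˡ _) (*-identityʳ _))
  qbin-qfac (suc n) (suc k) (suc r) e = begin
    (qbin n k + q ^ suc k * qbin n (suc k)) * (qnum (suc k) * qfac k * (qnum (suc r) * qfac r))
      ≡⟨ regroup (qbin n k) (q ^ suc k) (qbin n (suc k)) (qnum (suc k)) (qfac k) (qnum (suc r)) (qfac r) ⟩
    qnum (suc k) * (qbin n k * (qfac k * qfac (suc r))) + q ^ suc k * qnum (suc r) * (qbin n (suc k) * (qfac (suc k) * qfac r))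
      ≡⟨ cong₂ (λ a b → qnum (suc k) * a + q ^ suc k * qnum (suc r) * b)
               (qbin-qfac n k (suc r) (suc-injective e)) (qbin-qfac n (suc k) r (trans (sym (+-suc k r)) (suc-injective e))) ⟩
    qnum (suc k) * qfac n + q ^ suc k * qnum (suc r) * qfac n
      ≡⟨ sym (*-distribʳ-+ (qfac n) (qnum (suc k)) _) ⟩
    (qnum (suc k) + q ^ suc k * qnum (suc r)) * qfac n
      ≡⟨ cong (_* qfac n) (sym (qnum-+ (suc k) (suc r))) ⟩
    qnum (suc k + suc r) * qfac n
      ≡⟨ cong (λ x → qnum x * qfac n) e ⟩
    qfac (suc n) ∎
    where open ≡-Reasoning
          regroup : ∀ a b c d e f g → (a + b * c) * (d * e * (f * g)) ≡ d * (a * (e * (f * g))) + b * f * (c * (d * e * g))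
          regroup = solve-∀

  qbin-pascalʳ : ∀ k r → qbin (suc (k + r)) (suc k) ≡ qbin (k + r) (suc k) + q ^ r * qbin (k + r) k
  qbin-pascalʳ k zero rewrite +-identityʳ k =
    trans (qbin-diag (suc k)) (sym (cong₂ (λ a b → a + 1 * b) (qbin-< (n<1+n k)) (qbin-diag k)))
  qbin-pascalʳ k (suc r) = *-cancelʳ-≡ _ _ (qfac (suc k) * qfac (suc r)) {{qfac*qfac-nonZero (suc k) (suc r)}} (begin
    qbin (suc n) (suc k) * (qfac (suc k) * qfac (suc r))
      ≡⟨ qbin-qfac (suc n) (suc k) (suc r) refl ⟩
    qnum (suc n) * qfac n
      ≡⟨ cong (λ x → qnum x * qfac n) (trans (cong suc (+-comm k (suc r))) (sym (+-suc (suc r) k))) ⟩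
    qnum (suc r + suc k) * qfac n
      ≡⟨ cong (_* qfac n) (qnum-+ (suc r) (suc k)) ⟩
    (qnum (suc r) + q ^ suc r * qnum (suc k)) * qfac n
      ≡⟨ *-distribʳ-+ (qfac n) (qnum (suc r)) _ ⟩
    qnum (suc r) * qfac n + q ^ suc r * qnum (suc k) * qfac n
      ≡⟨ cong₂ (λ a b → qnum (suc r) * a + q ^ suc r * qnum (suc k) * b)
               (sym (qbin-qfac n (suc k) r (sym (+-suc k r)))) (sym (qbin-qfac n k (suc r) refl)) ⟩
    qnum (suc r) * (qbin n (suc k) * (qfac (suc k) * qfac r)) + q ^ suc r * qnum (suc k) * (qbin n k * (qfac k * qfac (suc r)))
      ≡⟨ regroup (qnum (suc r)) (qbin n (suc k)) (qnum (suc k)) (qfac k) (qfac r) (q ^ suc r) (qbin n k) ⟩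
    (qbin n (suc k) + q ^ suc r * qbin n k) * (qfac (suc k) * qfac (suc r)) ∎)
    where open ≡-Reasoning
          n = k + suc r
          regroup : ∀ a b f h d e g → a * (b * (f * h * d)) + e * f * (g * (h * (a * d))) ≡ (b + e * g) * (f * h * (a * d))
          regroup = solve-∀

  qbin-absorb : ∀ k r → qbin (suc (k + r)) k * qnum (suc r) ≡ qnum (suc (k + r)) * qbin (k + r) k
  qbin-absorb k r = *-cancelʳ-≡ _ _ (qfac k * qfac r) {{qfac*qfac-nonZero k r}} (begin
    qbin (suc (k + r)) k * qnum (suc r) * (qfac k * qfac r)
      ≡⟨ regroup (qbin (suc (k + r)) k) (qnum (suc r)) (qfac k) (qfac r) ⟩
    qbin (suc (k + r)) k * (qfac k * qfac (suc r))
      ≡⟨ qbin-qfac (suc (k + r)) k (suc r) (+-suc k r) ⟩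
    qfac (suc (k + r))
      ≡⟨ cong (qnum (suc (k + r)) *_) (sym (qbin-qfac (k + r) k r refl)) ⟩
    qnum (suc (k + r)) * (qbin (k + r) k * (qfac k * qfac r))
      ≡⟨ sym (*-assoc (qnum (suc (k + r))) (qbin (k + r) k) (qfac k * qfac r)) ⟩
    qnum (suc (k + r)) * qbin (k + r) k * (qfac k * qfac r) ∎)
    where open ≡-Reasoning
          regroup : ∀ a b c d → a * b * (c * d) ≡ a * (c * (b * d))
          regroup = solve-∀

  -- Closed forms for the partial permutations ending in a numeral (or empty) and in a hole.
  qbinEndNum qbinEndHole : ℕ → ℕ → ℕ
  qbinEndNum zero    k = qbin zero k
  qbinEndNum (suc L) k = q ^ k * qbin L k

  qbinEndHole zero    k       = 0
  qbinEndHole (suc L) zero    = 0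
  qbinEndHole (suc L) (suc k) = qbin L k

  qbin-endNum+endHole : ∀ L k → qbin L k ≡ qbinEndNum L k + qbinEndHole L k
  qbin-endNum+endHole zero    k       = sym (+-identityʳ _)
  qbin-endNum+endHole (suc L) zero    = sym (cong (λ x → 1 * x + 0) (qbin-zero L))
  qbin-endNum+endHole (suc L) (suc k) = +-comm (qbin L k) _

  qbin-splitEnd : ∀ k r → q ^ k * qbin (k + r) k ≡ qbinEndNum (k + r) k + q ^ (k + r) * qbinEndHole (k + r) k
  qbin-splitEnd zero    zero    = refl
  qbin-splitEnd zero    (suc r) = sym (cong₂ (λ a b → 1 * a + b) (qbin-zero r) (*-zeroʳ (q ^ suc r)))
  qbin-splitEnd (suc k) r = begin
    q ^ suc k * qbin (suc (k + r)) (suc k)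
      ≡⟨ cong (q ^ suc k *_) (qbin-pascalʳ k r) ⟩
    q ^ suc k * (qbin (k + r) (suc k) + q ^ r * qbin (k + r) k)
      ≡⟨ *-distribˡ-+ (q ^ suc k) _ _ ⟩
    q ^ suc k * qbin (k + r) (suc k) + q ^ suc k * (q ^ r * qbin (k + r) k)
      ≡⟨ cong (q ^ suc k * qbin (k + r) (suc k) +_) (sym (*-assoc (q ^ suc k) _ _)) ⟩
    q ^ suc k * qbin (k + r) (suc k) + q ^ suc k * q ^ r * qbin (k + r) k
      ≡⟨ cong (λ x → q ^ suc k * qbin (k + r) (suc k) + x * qbin (k + r) k) (sym (q^-+ (suc k) r)) ⟩
    q ^ suc k * qbin (k + r) (suc k) + q ^ (suc k + r) * qbin (k + r) k ∎
    where open ≡-Reasoning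

  qbin-absorbEnd : ∀ k r → q ^ k * qbin (k + r) k * qnum r ≡ qnum (k + r) * qbinEndNum (k + r) k
  qbin-absorbEnd zero    zero    = refl
  qbin-absorbEnd (suc k) zero rewrite +-identityʳ k =
    trans (*-zeroʳ (q ^ suc k * qbin (suc k) (suc k))) (sym (begin
      qnum (suc k) * (q ^ suc k * qbin k (suc k)) ≡⟨ cong (λ x → qnum (suc k) * (q ^ suc k * x)) (qbin-< (n<1+n k)) ⟩
      qnum (suc k) * (q ^ suc k * 0)              ≡⟨ cong (qnum (suc k) *_) (*-zeroʳ (q ^ suc k)) ⟩
      qnum (suc k) * 0                            ≡⟨ *-zeroʳ (qnum (suc k)) ⟩
      0                                           ∎))
    where open ≡-Reasoning
  qbin-absorbEnd k (suc r) rewrite +-suc k r = begin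
    q ^ k * qbin (suc (k + r)) k * qnum (suc r)   ≡⟨ *-assoc (q ^ k) (qbin (suc (k + r)) k) (qnum (suc r)) ⟩
    q ^ k * (qbin (suc (k + r)) k * qnum (suc r)) ≡⟨ cong (q ^ k *_) (qbin-absorb k r) ⟩
    q ^ k * (qnum (suc (k + r)) * qbin (k + r) k) ≡⟨ *-CS.x∙yz≈y∙xz (q ^ k) (qnum (suc (k + r))) (qbin (k + r) k) ⟩
    qnum (suc (k + r)) * (q ^ k * qbin (k + r) k) ∎
    where open ≡-Reasoning

  -- The identity behind the maj recursion; a is the weight of the slot where the
  -- inserted largest value may become a right-to-left minimum.
  qbin-insertion : ∀ a k r →
    q ^ k * qbin (k + r) k * (a + q * qnum r)
      ≡ (a + q * qnum (k + r)) * qbinEndNum (k + r) k + a * q ^ (k + r) * qbinEndHole (k + r) k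
  qbin-insertion a k r = begin
    X * (a + q * qnum r)                                 ≡⟨ expand X a q (qnum r) ⟩
    a * X + q * (X * qnum r)                             ≡⟨ cong₂ (λ x y → a * x + q * y) (qbin-splitEnd k r) (qbin-absorbEnd k r) ⟩
    a * (E + q ^ L * H) + q * (qnum L * E)               ≡⟨ collect a E (q ^ L) H q (qnum L) ⟩
    (a + q * qnum L) * E + a * q ^ L * H                 ∎
    where open ≡-Reasoning
          L = k + r
          X = q ^ k * qbin L k
          E = qbinEndNum L k
          H = qbinEndHole L k
          expand : ∀ x a q y → x * (a + q * y) ≡ a * x + q * (x * y)
          expand = solve-∀
          collect : ∀ a e s h q y → a * (e + s * h) + q * (y * e) ≡ (a + q * y) * e + a * s * h
          collect = solve-∀

  βqfall : ℕ → ℕ → ℕ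
  βqfall N zero    = 1
  βqfall N (suc r) = βqnum N * βqfall (N ∸ 1) r

  βqfall-suc : ∀ N r → βqfall N (suc r) ≡ βqnum (N ∸ r) * βqfall N r
  βqfall-suc N zero    = refl
  βqfall-suc N (suc r) = begin
    βqnum N * βqfall (N ∸ 1) (suc r)                   ≡⟨ cong (βqnum N *_) (βqfall-suc (N ∸ 1) r) ⟩
    βqnum N * (βqnum (N ∸ 1 ∸ r) * βqfall (N ∸ 1) r)   ≡⟨ cong (λ x → βqnum N * (βqnum x * βqfall (N ∸ 1) r)) (∸-+-assoc N 1 r) ⟩
    βqnum N * (βqnum (N ∸ suc r) * βqfall (N ∸ 1) r)   ≡⟨ *-CS.x∙yz≈y∙xz (βqnum N) (βqnum (N ∸ suc r)) (βqfall (N ∸ 1) r) ⟩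
    βqnum (N ∸ suc r) * (βqnum N * βqfall (N ∸ 1) r)   ∎
    where open ≡-Reasoning

  qbin-βqfall-suc : ∀ N L k → qbin L k * βqfall N (suc L ∸ k) ≡ βqnum (N ∸ (L ∸ k)) * (qbin L k * βqfall N (L ∸ k))
  qbin-βqfall-suc N L k with k ≤? L
  ... | yes k≤L = begin
    qbin L k * βqfall N (suc L ∸ k)                  ≡⟨ cong (λ r → qbin L k * βqfall N r) (+-∸-assoc 1 k≤L) ⟩
    qbin L k * βqfall N (suc (L ∸ k))                ≡⟨ cong (qbin L k *_) (βqfall-suc N (L ∸ k)) ⟩
    qbin L k * (βqnum (N ∸ (L ∸ k)) * βqfall N (L ∸ k)) ≡⟨ *-CS.x∙yz≈y∙xz (qbin L k) (βqnum (N ∸ (L ∸ k))) (βqfall N (L ∸ k)) ⟩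
    βqnum (N ∸ (L ∸ k)) * (qbin L k * βqfall N (L ∸ k)) ∎
    where open ≡-Reasoning
  ... | no k≰L = begin
    qbin L k * βqfall N (suc L ∸ k)                    ≡⟨ cong (_* βqfall N (suc L ∸ k)) L<k ⟩
    0                                                  ≡⟨ sym (*-zeroʳ (βqnum (N ∸ (L ∸ k)))) ⟩
    βqnum (N ∸ (L ∸ k)) * 0                            ≡⟨ cong (λ x → βqnum (N ∸ (L ∸ k)) * (x * βqfall N (L ∸ k))) (sym L<k) ⟩
    βqnum (N ∸ (L ∸ k)) * (qbin L k * βqfall N (L ∸ k)) ∎
    where open ≡-Reasoning
          L<k : qbin L k ≡ 0
          L<k = qbin-< (≰⇒> k≰L)

  qbin-βqfall-emptyAlphabet : ∀ L k → qbin L k * βqfall 0 (suc L ∸ k) ≡ 0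
  qbin-βqfall-emptyAlphabet L k =
    trans (qbin-βqfall-suc 0 L k) (cong (λ c → βqnum c * (qbin L k * βqfall 0 (L ∸ k))) (0∸n≡0 (L ∸ k)))

  βqfall-> : ∀ {N r} → N < r → βqfall N r ≡ 0
  βqfall-> {N} {suc r} (s≤s N≤r) = begin
    βqfall N (suc r)              ≡⟨ βqfall-suc N r ⟩
    βqnum (N ∸ r) * βqfall N r    ≡⟨ cong (λ c → βqnum c * βqfall N r) (m≤n⇒m∸n≡0 N≤r) ⟩
    0                             ∎
    where open ≡-Reasoning

  βqfall-split : ∀ N r → βqnum (suc N) * βqfall N r ≡ (βqnum (N ∸ r) + q ^ (N ∸ r) * (βif (N ∸ r ≡ᵇ 0) + q * qnum r)) * βqfall N r
  βqfall-split N r with r ≤? N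
  ... | yes r≤N = cong (_* βqfall N r) (trans (cong (βqnum ∘ suc) (sym (m∸n+n≡m r≤N))) (βqnum-split (N ∸ r) r))
  ... | no  r≰N = trans (cong (βqnum (suc N) *_) (βqfall-> (≰⇒> r≰N)))
                        (trans (*-zeroʳ (βqnum (suc N))) (sym (trans (cong (b *_) (βqfall-> (≰⇒> r≰N))) (*-zeroʳ b))))
    where b = βqnum (N ∸ r) + q ^ (N ∸ r) * (βif (N ∸ r ≡ᵇ 0) + q * qnum r)

  qbinEndNum-< : ∀ {L k} → L < k → qbinEndNum L k ≡ 0
  qbinEndNum-< {zero}  L<k       = qbin-< L<k
  qbinEndNum-< {suc L} {k} L<k = trans (cong (q ^ k *_) (qbin-< (<-trans (n<1+n L) L<k))) (*-zeroʳ (q ^ k))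

  qbinEndHole-< : ∀ {L k} → L < k → qbinEndHole L k ≡ 0
  qbinEndHole-< {zero}              _         = refl
  qbinEndHole-< {suc L} {suc k}     (s≤s L<k) = qbin-< L<k

  qbinEnd-insertion : ∀ N L k r → k + r ≡ L → let c = N ∸ r ; a = βif (c ≡ᵇ 0) in
    qbinEndNum (suc L) k * βqfall (suc N) (suc r)
      ≡ qbinEndNum (suc L) k * βqfall N (suc r)
        + q ^ c * ((a + q * qnum L) * (qbinEndNum L k * βqfall N r) + a * q ^ L * (qbinEndHole L k * βqfall N r))
  qbinEnd-insertion N .(k + r) k r refl = begin
    E₁ * (βqnum (suc N) * P)
      ≡⟨ cong (E₁ *_) (βqfall-split N r) ⟩
    E₁ * ((βqnum c + q ^ c * (a + q * qnum r)) * P)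
      ≡⟨ distrib E₁ (βqnum c) (q ^ c) (a + q * qnum r) P ⟩
    E₁ * (βqnum c * P) + q ^ c * (E₁ * (a + q * qnum r) * P)
      ≡⟨ cong₂ (λ x y → E₁ * x + q ^ c * (y * P)) (sym (βqfall-suc N r)) (qbin-insertion a k r) ⟩
    E₁ * βqfall N (suc r) + q ^ c * (((a + q * qnum L) * En + a * q ^ L * Hn) * P)
      ≡⟨ cong (λ x → E₁ * βqfall N (suc r) + q ^ c * x) (distribʳ (a + q * qnum L) En (a * q ^ L) Hn P) ⟩
    E₁ * βqfall N (suc r) + q ^ c * ((a + q * qnum L) * (En * P) + a * q ^ L * (Hn * P)) ∎
    where
    open ≡-Reasoning
    L = k + r
    E₁ = q ^ k * qbin L k
    En = qbinEndNum L k
    Hn = qbinEndHole L k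
    P = βqfall N r
    c = N ∸ r
    a = βif (c ≡ᵇ 0)
    distrib : ∀ e b t x p → e * ((b + t * x) * p) ≡ e * (b * p) + t * (e * x * p)
    distrib = solve-∀
    distribʳ : ∀ y e s h p → (y * e + s * h) * p ≡ y * (e * p) + s * (h * p)
    distribʳ = solve-∀

  qbinEnd-insertion-step : ∀ N L k → let c = N ∸ (L ∸ k) ; a = βif (c ≡ᵇ 0) in
    qbinEndNum (suc L) k * βqfall (suc N) (suc L ∸ k)
      ≡ qbinEndNum (suc L) k * βqfall N (suc L ∸ k)
        + q ^ c * ((a + q * qnum L) * (qbinEndNum L k * βqfall N (L ∸ k)) + a * q ^ L * (qbinEndHole L k * βqfall N (L ∸ k)))
  qbinEnd-insertion-step N L k with k ≤? L
  ... | yes k≤L rewrite +-∸-assoc 1 k≤L = qbinEnd-insertion N L k (L ∸ k) (m+[n∸m]≡n k≤L)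
  ... | no  k≰L rewrite qbin-< (≰⇒> k≰L) | qbinEndNum-< (≰⇒> k≰L) | qbinEndHole-< (≰⇒> k≰L) =
    vanish (q ^ k) (βqfall (suc N) (suc L ∸ k)) (βqfall N (suc L ∸ k)) (q ^ c) (a + q * qnum L) (a * q ^ L) (βqfall N (L ∸ k))
    where c = N ∸ (L ∸ k)
          a = βif (c ≡ᵇ 0)
          vanish : ∀ t x y c b s p → t * 0 * x ≡ t * 0 * y + c * (b * (0 * p) + s * (0 * p))
          vanish = solve-∀

  β^ind≡βif : ∀ b → β ^ ind b ≡ βif b
  β^ind≡βif true  = *-identityʳ β
  β^ind≡βif false = refl

  qint≡qnum : ∀ m → qint m q ≡ qnum m
  qint≡qnum zero    = refl
  qint≡qnum (suc m) = trans (∑-upTo-sucʳ m (q ^_)) (trans (cong (_+ q ^ m) (qint≡qnum m)) (sym (qnum-suc m)))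

  βqint≡βqnum : ∀ m → βqint (suc m) β q ≡ βqnum (suc m)
  βqint≡βqnum m = cong (β +_) (trans (∑-*ˡ (upTo m) q (q ^_)) (cong (q *_) (qint≡qnum m)))

  qfact≡qfac : ∀ m → qfact m q ≡ qfac m
  qfact≡qfac zero    = refl
  qfact≡qfac (suc m) = cong₂ _*_ (qint≡qnum (suc m)) (qfact≡qfac m)

  qbinom≡qbin : ∀ {n k} → k ≤ n → qbinom n k q ≡ qbin n k
  qbinom≡qbin {n} {k} k≤n = begin
    qbinom n k q                                         ≡⟨ cong (λ x → _/_ x d {{d≢0}}) qfact-split ⟩
    _/_ (qbin n k * d) d {{d≢0}}                         ≡⟨ m*n/n≡m (qbin n k) d {{d≢0}} ⟩
    qbin n k                                             ∎
    where open ≡-Reasoning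
          d = qfact k q * qfact (n ∸ k) q
          d≢0 = m*n≢0 (qfact k q) (qfact (n ∸ k) q) {{qfact-nz k q}} {{qfact-nz (n ∸ k) q}}
          qfact-split : qfact n q ≡ qbin n k * d
          qfact-split = begin
            qfact n q                          ≡⟨ qfact≡qfac n ⟩
            qfac n                             ≡⟨ sym (qbin-qfac n k (n ∸ k) (m+[n∸m]≡n k≤n)) ⟩
            qbin n k * (qfac k * qfac (n ∸ k)) ≡⟨ cong (qbin n k *_) (sym (cong₂ _*_ (qfact≡qfac k) (qfact≡qfac (n ∸ k)))) ⟩
            qbin n k * d                       ∎

  βqint-product≡βqfall : ∀ k m → product (map (λ x → βqint x β q) (applyUpTo (λ i → suc (k + i)) m)) ≡ βqfall (k + m) m
  βqint-product≡βqfall k zero    = refl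
  βqint-product≡βqfall k (suc m) = begin
    product (map B (applyUpTo f (suc m)))      ≡⟨ cong (product ∘ map B) (sym (applyUpTo-∷ʳ f m)) ⟩
    product (map B (applyUpTo f m ∷ʳ f m))     ≡⟨ cong product (map-++ B (applyUpTo f m) [ f m ]) ⟩
    product (map B (applyUpTo f m) ++ [ B (f m) ]) ≡⟨ product-++ (map B (applyUpTo f m)) [ B (f m) ] ⟩
    product (map B (applyUpTo f m)) * (B (f m) * 1) ≡⟨ cong₂ (λ x y → x * (y * 1)) (βqint-product≡βqfall k m) (βqint≡βqnum (k + m)) ⟩
    βqfall (k + m) m * (βqnum (suc (k + m)) * 1)   ≡⟨ cong (βqfall (k + m) m *_) (*-identityʳ _) ⟩
    βqfall (k + m) m * βqnum (suc (k + m))       ≡⟨ *-comm (βqfall (k + m) m) _ ⟩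
    βqfall (suc (k + m)) (suc m)               ≡⟨ cong (λ N → βqfall N (suc m)) (sym (+-suc k m)) ⟩
    βqfall (k + suc m) (suc m)                 ∎
    where open ≡-Reasoning
          f = λ i → suc (k + i)
          B = λ x → βqint x β q

  βqprod≡βqfall : ∀ {n k} → k ≤ n → βqprod n k β q ≡ βqfall n (n ∸ k)
  βqprod≡βqfall {n} {k} k≤n = trans (βqint-product≡βqfall k (n ∸ k)) (cong (λ N → βqfall N (n ∸ k)) (m+[n∸m]≡n k≤n))

-- Words, partial permutations and their statistics
InRange : ℕ → ℕ → Set
InRange N a = 1 ≤ a × a ≤ N

LetterOf : ℕ → Letter → Set
LetterOf N nothing  = ⊤
LetterOf N (just a) = InRange N a

WordOver : ℕ → ℕ → Word → Set
WordOver N L w = length w ≡ L × All (LetterOf N) w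

range1-suc : ∀ N → range1 (suc N) ≡ range1 N ∷ʳ suc N
range1-suc N = sym (applyUpTo-∷ʳ suc N)

range1-InRange : ∀ N → All (InRange N) (range1 N)
range1-InRange N = All.applyUpTo⁺₁ suc N (λ i<N → s≤s z≤n , i<N)

numerals-InRange : ∀ {N} (w : Word) → All (LetterOf N) w → All (InRange N) (numerals w)
numerals-InRange []             []         = []
numerals-InRange (nothing ∷ w)  (_ ∷ pw)   = numerals-InRange w pw
numerals-InRange (just a ∷ w)   (pa ∷ pw)  = pa ∷ numerals-InRange w pw

allWords-WordOver : ∀ N L → All (WordOver N L) (allWords N L)
allWords-WordOver N zero    = (refl , []) ∷ []
allWords-WordOver N (suc L) = prepend (letters N) (tt ∷ All.map⁺ (range1-InRange N))
  where
  prepend : ∀ xs → All (LetterOf N) xs → All (WordOver N (suc L)) (concatMap (λ x → map (x ∷_) (allWords N L)) xs)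
  prepend []       []         = []
  prepend (x ∷ xs) (px ∷ pxs) =
    All.++⁺ (All.map⁺ (All.map (λ (len , pw) → cong suc len , px ∷ pw) (allWords-WordOver N L))) (prepend xs pxs)

∑-letters : ∀ N (f : Letter → ℕ) → ∑ (letters N) f ≡ f nothing + ∑[ a ∈ range1 N ] f (just a)
∑-letters N f = cong (f nothing +_) (∑-map just (range1 N) f)

∑-letters-suc : ∀ N (f : Letter → ℕ) → ∑ (letters (suc N)) f ≡ ∑ (letters N) f + f (just (suc N))
∑-letters-suc N f = begin
  f nothing + ∑ (map just (range1 (suc N))) f            ≡⟨ cong (λ xs → f nothing + ∑ (map just xs) f) (range1-suc N) ⟩
  f nothing + ∑ (map just (range1 N ∷ʳ suc N)) f        ≡⟨ cong (λ xs → f nothing + ∑ xs f) (map-++ just (range1 N) [ suc N ]) ⟩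
  f nothing + ∑ (map just (range1 N) ∷ʳ just (suc N)) f ≡⟨ cong (f nothing +_) (∑-∷ʳ (map just (range1 N)) (just (suc N)) f) ⟩
  f nothing + (∑ (map just (range1 N)) f + f (just (suc N))) ≡⟨ sym (+-assoc (f nothing) _ _) ⟩
  ∑ (letters N) f + f (just (suc N))                     ∎
  where open ≡-Reasoning

∑-allWords-suc : ∀ N L (f : Word → ℕ) → ∑ (allWords N (suc L)) f ≡ ∑[ x ∈ letters N ] ∑[ w ∈ allWords N L ] f (x ∷ w)
∑-allWords-suc N L f =
  trans (∑-concatMap (λ x → map (x ∷_) (allWords N L)) (letters N) f) (∑-cong (letters N) (λ x → ∑-map (x ∷_) (allWords N L) f))

∑-allWords-∷ʳ : ∀ N L (f : Word → ℕ) → ∑ (allWords N (suc L)) f ≡ ∑[ w ∈ allWords N L ] ∑[ x ∈ letters N ] f (w ∷ʳ x)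
∑-allWords-∷ʳ N zero    f = trans (∑-allWords-suc N 0 f)
  (trans (∑-cong (letters N) (λ x → +-identityʳ (f (x ∷ [])))) (sym (+-identityʳ _)))
∑-allWords-∷ʳ N (suc L) f = begin
  ∑ (allWords N (suc (suc L))) f
    ≡⟨ ∑-allWords-suc N (suc L) f ⟩
  ∑[ x ∈ letters N ] ∑[ w ∈ allWords N (suc L) ] f (x ∷ w)
    ≡⟨ ∑-cong (letters N) (λ x → ∑-allWords-∷ʳ N L (λ w → f (x ∷ w))) ⟩
  ∑[ x ∈ letters N ] ∑[ w ∈ allWords N L ] ∑[ y ∈ letters N ] f (x ∷ w ∷ʳ y)
    ≡⟨ sym (∑-allWords-suc N L (λ w → ∑[ y ∈ letters N ] f (w ∷ʳ y))) ⟩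
  ∑[ w ∈ allWords N (suc L) ] ∑[ y ∈ letters N ] f (w ∷ʳ y) ∎
  where open ≡-Reasoning

elemℕ-++ : ∀ b xs ys → elemℕ b (xs ++ ys) ≡ elemℕ b xs ∨ elemℕ b ys
elemℕ-++ b []       ys = refl
elemℕ-++ b (x ∷ xs) ys = trans (cong ((b ≡ᵇ x) ∨_) (elemℕ-++ b xs ys)) (sym (∨-assoc (b ≡ᵇ x) _ _))

elemℕ-∷ʳ : ∀ b xs a → elemℕ b (xs ∷ʳ a) ≡ elemℕ b xs ∨ (b ≡ᵇ a)
elemℕ-∷ʳ b xs a = trans (elemℕ-++ b xs [ a ]) (cong (elemℕ b xs ∨_) (∨-identityʳ (b ≡ᵇ a)))

noDup-∷ʳ : ∀ xs a → noDup (xs ∷ʳ a) ≡ noDup xs ∧ not (elemℕ a xs)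
noDup-∷ʳ []       a = refl
noDup-∷ʳ (x ∷ xs) a = begin
  not (elemℕ x (xs ∷ʳ a)) ∧ noDup (xs ∷ʳ a)
    ≡⟨ cong₂ (λ u v → not u ∧ v) (elemℕ-∷ʳ x xs a) (noDup-∷ʳ xs a) ⟩
  not (elemℕ x xs ∨ (x ≡ᵇ a)) ∧ (noDup xs ∧ not (elemℕ a xs))
    ≡⟨ regroup (elemℕ x xs) (x ≡ᵇ a) (noDup xs) (elemℕ a xs) ⟩
  (not (elemℕ x xs) ∧ noDup xs) ∧ not ((x ≡ᵇ a) ∨ elemℕ a xs)
    ≡⟨ cong (λ u → (not (elemℕ x xs) ∧ noDup xs) ∧ not (u ∨ elemℕ a xs)) (≡ᵇ-sym x a) ⟩
  (not (elemℕ x xs) ∧ noDup xs) ∧ not ((a ≡ᵇ x) ∨ elemℕ a xs) ∎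
  where
  open ≡-Reasoning
  regroup : ∀ p e n r → not (p ∨ e) ∧ (n ∧ not r) ≡ (not p ∧ n) ∧ not (e ∨ r)
  regroup true  e     n     r = refl
  regroup false true  true  r = refl
  regroup false true  false r = refl
  regroup false false n     r = refl

numerals-∷ʳ-hole : ∀ w → numerals (w ∷ʳ nothing) ≡ numerals w
numerals-∷ʳ-hole w = trans (catMaybes-++ w [ nothing ]) (++-identityʳ _)

numerals-∷ʳ : ∀ w a → numerals (w ∷ʳ just a) ≡ numerals w ∷ʳ a
numerals-∷ʳ w a = catMaybes-++ w [ just a ]

holes-∷ʳ : ∀ w x → holes (w ∷ʳ x) ≡ holes w + ind (isHole x)
holes-∷ʳ w x = countB-∷ʳ isHole w x

isPartialPerm : ℕ → Word → Bool
isPartialPerm k w = (holes w ≡ᵇ k) ∧ noDup (numerals w)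

isPartialPerm-∷ʳ-hole : ∀ k w → isPartialPerm k (w ∷ʳ nothing) ≡ (suc (holes w) ≡ᵇ k) ∧ noDup (numerals w)
isPartialPerm-∷ʳ-hole k w =
  cong₂ (λ h T → (h ≡ᵇ k) ∧ noDup T) (trans (holes-∷ʳ w nothing) (+-comm (holes w) 1)) (numerals-∷ʳ-hole w)

isPartialPerm-∷ʳ : ∀ k w a → isPartialPerm k (w ∷ʳ just a) ≡ isPartialPerm k w ∧ not (elemℕ a (numerals w))
isPartialPerm-∷ʳ k w a = begin
  (holes (w ∷ʳ just a) ≡ᵇ k) ∧ noDup (numerals (w ∷ʳ just a))
    ≡⟨ cong₂ (λ h T → (h ≡ᵇ k) ∧ noDup T) (trans (holes-∷ʳ w (just a)) (+-identityʳ (holes w))) (numerals-∷ʳ w a) ⟩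
  (holes w ≡ᵇ k) ∧ noDup (numerals w ∷ʳ a)
    ≡⟨ cong ((holes w ≡ᵇ k) ∧_) (noDup-∷ʳ (numerals w) a) ⟩
  (holes w ≡ᵇ k) ∧ (noDup (numerals w) ∧ not (elemℕ a (numerals w)))
    ≡⟨ sym (∧-assoc (holes w ≡ᵇ k) _ _) ⟩
  isPartialPerm k w ∧ not (elemℕ a (numerals w)) ∎
  where open ≡-Reasoning

isPartialPerm⇒noDup : ∀ k w → isPartialPerm k w ≡ true → noDup (numerals w) ≡ true
isPartialPerm⇒noDup k w e with holes w ≡ᵇ k
... | true = e

isPartialPerm⇒holes : ∀ k w → isPartialPerm k w ≡ true → holes w ≡ k
isPartialPerm⇒holes k w e with holes w ≡ᵇ k in eq
... | true = ≡ᵇ-true⇒≡ (holes w) k eq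

isRlmin : List ℕ → ℕ → Bool
isRlmin T a = all (λ b → elemℕ b T) (range1 (a ∸ 1))

rlminAt : Word → Letter → ℕ
rlminAt pre nothing  = 0
rlminAt pre (just a) = ind (isRlmin (numerals pre) a)

rlmin-∷ʳ : ∀ pre w x → rlminAux pre (w ∷ʳ x) ≡ rlminAux pre w + rlminAt (pre ++ w) x
rlmin-∷ʳ pre []            nothing  = refl
rlmin-∷ʳ pre []            (just a) =
  trans (+-identityʳ (rlminAt pre (just a))) (cong (λ p → rlminAt p (just a)) (sym (++-identityʳ pre)))
rlmin-∷ʳ pre (nothing ∷ w) x =
  trans (rlmin-∷ʳ (pre ∷ʳ nothing) w x) (cong (λ p → rlminAux (pre ∷ʳ nothing) w + rlminAt p x) (++-assoc pre _ w))
rlmin-∷ʳ pre (just a ∷ w)  x = begin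
  r + rlminAux (pre ∷ʳ just a) (w ∷ʳ x)                    ≡⟨ cong (r +_) (rlmin-∷ʳ (pre ∷ʳ just a) w x) ⟩
  r + (rlminAux (pre ∷ʳ just a) w + rlminAt ((pre ∷ʳ just a) ++ w) x) ≡⟨ sym (+-assoc r _ _) ⟩
  r + rlminAux (pre ∷ʳ just a) w + rlminAt ((pre ∷ʳ just a) ++ w) x  ≡⟨ cong (λ p → r + rlminAux (pre ∷ʳ just a) w + rlminAt p x) (++-assoc pre _ w) ⟩
  r + rlminAux (pre ∷ʳ just a) w + rlminAt (pre ++ just a ∷ w) x     ∎
  where open ≡-Reasoning
        r = rlminAt pre (just a)

inv0-∷ʳ : ∀ pre w x → inv0Aux pre (w ∷ʳ x) ≡ inv0Aux pre w + countB (_>ᴸ x) (pre ++ w)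
inv0-∷ʳ pre []      x = trans (+-identityʳ _) (cong (countB (_>ᴸ x)) (sym (++-identityʳ pre)))
inv0-∷ʳ pre (y ∷ w) x = begin
  c + inv0Aux (pre ∷ʳ y) (w ∷ʳ x)                              ≡⟨ cong (c +_) (inv0-∷ʳ (pre ∷ʳ y) w x) ⟩
  c + (inv0Aux (pre ∷ʳ y) w + countB (_>ᴸ x) ((pre ∷ʳ y) ++ w)) ≡⟨ sym (+-assoc c _ _) ⟩
  c + inv0Aux (pre ∷ʳ y) w + countB (_>ᴸ x) ((pre ∷ʳ y) ++ w)   ≡⟨ cong (λ p → c + inv0Aux (pre ∷ʳ y) w + countB (_>ᴸ x) p) (++-assoc pre _ w) ⟩
  c + inv0Aux (pre ∷ʳ y) w + countB (_>ᴸ x) (pre ++ y ∷ w)      ∎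
  where open ≡-Reasoning
        c = countB (_>ᴸ y) pre

lastExceeds : Word → Letter → Bool
lastExceeds []          y = false
lastExceeds (x ∷ [])    y = x >ᴸ y
lastExceeds (x ∷ z ∷ w) y = lastExceeds (z ∷ w) y

endsInHole : Word → Bool
endsInHole []          = false
endsInHole (x ∷ [])    = isHole x
endsInHole (x ∷ y ∷ w) = endsInHole (y ∷ w)

lastExceeds-∷ʳ : ∀ w x y → lastExceeds (w ∷ʳ x) y ≡ x >ᴸ y
lastExceeds-∷ʳ []          x y = refl
lastExceeds-∷ʳ (a ∷ [])    x y = refl
lastExceeds-∷ʳ (a ∷ b ∷ w) x y = lastExceeds-∷ʳ (b ∷ w) x y

endsInHole-∷ʳ : ∀ w x → endsInHole (w ∷ʳ x) ≡ isHole x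
endsInHole-∷ʳ []          x = refl
endsInHole-∷ʳ (a ∷ [])    x = refl
endsInHole-∷ʳ (a ∷ b ∷ w) x = endsInHole-∷ʳ (b ∷ w) x

lastExceeds-hole : ∀ w → lastExceeds w nothing ≡ false
lastExceeds-hole []                 = refl
lastExceeds-hole (nothing ∷ [])     = refl
lastExceeds-hole (just _ ∷ [])      = refl
lastExceeds-hole (x ∷ y ∷ w)        = lastExceeds-hole (y ∷ w)

onlyIf : Bool → ℕ → ℕ
onlyIf b n = if b then n else 0

maj0-∷ʳ : ∀ w y → maj0 (w ∷ʳ y) ≡ maj0 w + onlyIf (lastExceeds w y) (length w)
maj0-∷ʳ []      y = refl
maj0-∷ʳ (x ∷ w) y = from 1 x w
  where
  from : ∀ i x w → maj0Aux i ((x ∷ w) ∷ʳ y) ≡ maj0Aux i (x ∷ w) + (if lastExceeds (x ∷ w) y then i + length w else 0)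
  from i x []      with x >ᴸ y
  ... | true  = refl
  ... | false = refl
  from i x (z ∷ w) = begin
    d + maj0Aux (suc i) ((z ∷ w) ∷ʳ y)                    ≡⟨ cong (d +_) (from (suc i) z w) ⟩
    d + (maj0Aux (suc i) (z ∷ w) + (if e then suc i + length w else 0)) ≡⟨ sym (+-assoc d _ _) ⟩
    d + maj0Aux (suc i) (z ∷ w) + (if e then suc i + length w else 0)   ≡⟨ cong (λ n → d + maj0Aux (suc i) (z ∷ w) + (if e then n else 0)) (sym (+-suc i (length w))) ⟩
    d + maj0Aux (suc i) (z ∷ w) + (if e then i + suc (length w) else 0) ∎
    where open ≡-Reasoning
          d = if x >ᴸ z then i else 0
          e = lastExceeds (z ∷ w) y

length-∷ʳ : ∀ (w : Word) x → length (w ∷ʳ x) ≡ suc (length w)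
length-∷ʳ w x = trans (length-++ w) (+-comm (length w) 1)

countB-range1-single : ∀ {N a} → InRange N a → (g : ℕ → Bool) → countB (λ b → g b ∧ (b ≡ᵇ a)) (range1 N) ≡ ind (g a)
countB-range1-single {zero} {zero} (() , _) g
countB-range1-single {suc N} {a} (1≤a , a≤N+1) g = begin
  countB h (range1 (suc N))                   ≡⟨ cong (countB h) (range1-suc N) ⟩
  countB h (range1 N ∷ʳ suc N)                ≡⟨ countB-∷ʳ h (range1 N) (suc N) ⟩
  countB h (range1 N) + ind (h (suc N))       ≡⟨ split (m≤n⇒m<n∨m≡n a≤N+1) ⟩
  ind (g a)                                   ∎
  where
  open ≡-Reasoning
  h = λ b → g b ∧ (b ≡ᵇ a)
  split : a < suc N ⊎ a ≡ suc N → countB h (range1 N) + ind (h (suc N)) ≡ ind (g a)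
  split (inj₁ (s≤s a≤N)) = trans (cong₂ (λ x e → x + ind (g (suc N) ∧ e)) (countB-range1-single (1≤a , a≤N) g) (>⇒≢ᵇ (s≤s a≤N)))
                                 (trans (cong (λ e → ind (g a) + ind e) (∧-zeroʳ (g (suc N)))) (+-identityʳ _))
  split (inj₂ refl) = begin
    countB h (range1 N) + ind (h (suc N))
      ≡⟨ cong₂ (λ x e → x + ind (g (suc N) ∧ e))
               (countB-cong-All (range1-InRange N) (λ b (_ , b≤N) → trans (cong (g b ∧_) (<⇒≢ᵇ (s≤s b≤N))) (∧-zeroʳ (g b))))
               (≡ᵇ-refl (suc N)) ⟩
    countB (λ _ → false) (range1 N) + ind (g (suc N) ∧ true)
      ≡⟨ cong₂ (λ x e → x + ind e) (countB-false (range1 N)) (∧-identityʳ (g (suc N))) ⟩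
    ind (g (suc N)) ∎

countB-range1-elemℕ : ∀ {N} (T : List ℕ) → All (InRange N) T → noDup T ≡ true →
                      countB (λ b → elemℕ b T) (range1 N) ≡ length T
countB-range1-elemℕ {N} []      []         _  = countB-false (range1 N)
countB-range1-elemℕ {N} (s ∷ T) (s∈N ∷ T⊆N) nd with not (elemℕ s T) in s∉T | noDup T in ndT
... | true | true = trans (countB-∨ (_≡ᵇ s) (λ b → elemℕ b T) (range1 N) disjoint)
                          (cong₂ _+_ (countB-range1-single s∈N (λ _ → true)) (countB-range1-elemℕ T T⊆N ndT))
  where
  disjoint : ∀ b → ((b ≡ᵇ s) ∧ elemℕ b T) ≡ false
  disjoint b with b ≡ᵇ s in b≡s
  ... | false = refl
  ... | true with ≡ᵇ-true⇒≡ b s b≡s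
  ...   | refl = notTrue s∉T
    where notTrue : ∀ {x} → not x ≡ true → x ≡ false
          notTrue {false} _ = refl

missing : ℕ → List ℕ → ℕ
missing N T = countB (λ b → not (elemℕ b T)) (range1 N)

missingBelow : ℕ → List ℕ → ℕ → ℕ
missingBelow N T a = countB (λ b → not (elemℕ b T) ∧ (b <ᵇ a)) (range1 N)

missing+length : ∀ {N} (T : List ℕ) → All (InRange N) T → noDup T ≡ true → missing N T + length T ≡ N
missing+length {N} T T⊆N nd = begin
  missing N T + length T                                        ≡⟨ cong (missing N T +_) (sym (countB-range1-elemℕ T T⊆N nd)) ⟩
  missing N T + countB (λ b → elemℕ b T) (range1 N)             ≡⟨ countB-not+countB (λ b → elemℕ b T) (range1 N) ⟩
  length (range1 N)                                             ≡⟨ length-applyUpTo suc N ⟩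
  N                                                             ∎
  where open ≡-Reasoning

length-numerals+holes : ∀ (w : Word) → length (numerals w) + holes w ≡ length w
length-numerals+holes []            = refl
length-numerals+holes (nothing ∷ w) = trans (+-suc _ _) (cong suc (length-numerals+holes w))
length-numerals+holes (just a ∷ w)  = cong suc (length-numerals+holes w)

isPartialPerm⇒missing : ∀ {N L k} w → WordOver N L w → isPartialPerm k w ≡ true → missing N (numerals w) ≡ N ∸ (L ∸ k)
isPartialPerm⇒missing {N} {L} {k} w (len , w⊆N) pp = begin
  missing N ns                      ≡⟨ sym (m+n∸n≡m (missing N ns) (length ns)) ⟩
  missing N ns + length ns ∸ length ns ≡⟨ cong₂ _∸_ (missing+length ns (numerals-InRange w w⊆N) (isPartialPerm⇒noDup k w pp)) length-T ⟩
  N ∸ (L ∸ k)                      ∎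
  where
  open ≡-Reasoning
  ns = numerals w
  length-T : length ns ≡ L ∸ k
  length-T = trans (sym (m+n∸n≡m (length ns) (holes w)))
                   (cong₂ _∸_ (trans (length-numerals+holes w) len) (isPartialPerm⇒holes k w pp))

-- Appending a letter: the inv generating function
countB-exceeds-numeral : ∀ a (w : Word) → countB (_>ᴸ just a) w ≡ holes w + countB (a <ᵇ_) (numerals w)
countB-exceeds-numeral a []            = refl
countB-exceeds-numeral a (nothing ∷ w) = cong suc (countB-exceeds-numeral a w)
countB-exceeds-numeral a (just c ∷ w)  =
  trans (cong (ind (a <ᵇ c) +_) (countB-exceeds-numeral a w)) (+-CS.x∙yz≈y∙xz (ind (a <ᵇ c)) (holes w) _)

countB-exceeds-hole : ∀ (w : Word) → countB (_>ᴸ nothing) w ≡ 0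
countB-exceeds-hole []            = refl
countB-exceeds-hole (nothing ∷ w) = countB-exceeds-hole w
countB-exceeds-hole (just _ ∷ w)  = countB-exceeds-hole w

missingBelow-∷ʳ : ∀ {N} T {a} → InRange N a → elemℕ a T ≡ false →
                  ∀ c → missingBelow N (T ∷ʳ a) c + ind (a <ᵇ c) ≡ missingBelow N T c
missingBelow-∷ʳ {N} T {a} a∈N a∉T c = begin
  missingBelow N (T ∷ʳ a) c + ind (a <ᵇ c)
    ≡⟨ cong₂ _+_ (countB-cong (range1 N) (λ b → trans (cong (λ e → not e ∧ (b <ᵇ c)) (elemℕ-∷ʳ b T a))
                                                     (regroup (elemℕ b T) (b ≡ᵇ a) (b <ᵇ c))))
                 (cong (λ e → ind (not e ∧ (a <ᵇ c))) (sym a∉T)) ⟩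
  countB (λ b → g b ∧ not (b ≡ᵇ a)) (range1 N) + ind (g a)
    ≡⟨ cong (countB (λ b → g b ∧ not (b ≡ᵇ a)) (range1 N) +_) (sym (countB-range1-single a∈N g)) ⟩
  countB (λ b → g b ∧ not (b ≡ᵇ a)) (range1 N) + countB (λ b → g b ∧ (b ≡ᵇ a)) (range1 N)
    ≡⟨ sym (countB-split g (_≡ᵇ a) (range1 N)) ⟩
  missingBelow N T c ∎
  where
  open ≡-Reasoning
  g = λ b → not (elemℕ b T) ∧ (b <ᵇ c)
  regroup : ∀ x e y → not (x ∨ e) ∧ y ≡ (not x ∧ y) ∧ not e
  regroup true  e     y     = refl
  regroup false true  true  = refl
  regroup false true  false = refl
  regroup false false true  = refl
  regroup false false false = refl

missingBelow-∷ʳ-self : ∀ N T a → missingBelow N (T ∷ʳ a) a ≡ missingBelow N T a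
missingBelow-∷ʳ-self N T a = countB-cong (range1 N) (λ b →
  trans (cong (λ e → not e ∧ (b <ᵇ a)) (elemℕ-∷ʳ b T a)) (drop (elemℕ b T) (b ≡ᵇ a) (b <ᵇ a) (<ᵇ⇒≢ᵇ b a)))
  where
  drop : ∀ x e y → (y ≡ true → e ≡ false) → not (x ∨ e) ∧ y ≡ not x ∧ y
  drop true  e     y     _   = refl
  drop false true  true  y⇒¬e with y⇒¬e refl
  ... | ()
  drop false true  false _   = refl
  drop false false y     _   = refl

-- Adding a to T lowers the missing count below each larger c ∈ T by one, hence the
-- number of such c on the left.
invSets-∷ʳ : ∀ {N} T {a} → InRange N a → elemℕ a T ≡ false →
             ∑ (T ∷ʳ a) (missingBelow N (T ∷ʳ a)) + countB (a <ᵇ_) T ≡ ∑ T (missingBelow N T) + missingBelow N T a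
invSets-∷ʳ {N} T {a} a∈N a∉T = begin
  ∑ (T ∷ʳ a) (missingBelow N T′) + countB (a <ᵇ_) T
    ≡⟨ cong₂ _+_ (∑-∷ʳ T a (missingBelow N T′)) (countB≡∑ind (a <ᵇ_) T) ⟩
  ∑ T (missingBelow N T′) + missingBelow N T′ a + ∑[ c ∈ T ] ind (a <ᵇ c)
    ≡⟨ +-CS.xy∙z≈xz∙y (∑ T (missingBelow N T′)) _ _ ⟩
  ∑ T (missingBelow N T′) + ∑[ c ∈ T ] ind (a <ᵇ c) + missingBelow N T′ a
    ≡⟨ cong₂ _+_ (sym (∑-+ T (missingBelow N T′) _)) (missingBelow-∷ʳ-self N T a) ⟩
  ∑[ c ∈ T ] (missingBelow N T′ c + ind (a <ᵇ c)) + missingBelow N T a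
    ≡⟨ cong (_+ missingBelow N T a) (∑-cong T (missingBelow-∷ʳ T a∈N a∉T)) ⟩
  ∑ T (missingBelow N T) + missingBelow N T a ∎
  where
  open ≡-Reasoning
  T′ = T ∷ʳ a

inv-∷ʳ-hole : ∀ N w → inv N (w ∷ʳ nothing) ≡ inv N w
inv-∷ʳ-hole N w = cong₂ _+_
  (trans (inv0-∷ʳ [] w nothing) (trans (cong (inv0 w +_) (countB-exceeds-hole w)) (+-identityʳ _)))
  (cong (λ T → ∑ T (missingBelow N T)) (numerals-∷ʳ-hole w))

inv-∷ʳ : ∀ {N} w {a} → InRange N a → elemℕ a (numerals w) ≡ false →
         inv N (w ∷ʳ just a) ≡ inv N w + (holes w + missingBelow N (numerals w) a)
inv-∷ʳ {N} w {a} a∈N a∉w = +-cancelʳ-≡ above _ _ (begin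
  inv0 (w ∷ʳ just a) + invSets N (w ∷ʳ just a) + above
    ≡⟨ cong₂ (λ x y → x + y + above) (inv0-∷ʳ [] w (just a)) (cong (λ T′ → ∑ T′ (missingBelow N T′)) (numerals-∷ʳ w a)) ⟩
  inv0 w + countB (_>ᴸ just a) w + ∑ (T ∷ʳ a) (missingBelow N (T ∷ʳ a)) + above
    ≡⟨ cong (λ x → inv0 w + x + ∑ (T ∷ʳ a) (missingBelow N (T ∷ʳ a)) + above) (countB-exceeds-numeral a w) ⟩
  inv0 w + (holes w + above) + ∑ (T ∷ʳ a) (missingBelow N (T ∷ʳ a)) + above
    ≡⟨ regroup₁ (inv0 w) (holes w) above _ ⟩
  inv0 w + holes w + above + (∑ (T ∷ʳ a) (missingBelow N (T ∷ʳ a)) + above)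
    ≡⟨ cong (inv0 w + holes w + above +_) (invSets-∷ʳ T a∈N a∉w) ⟩
  inv0 w + holes w + above + (invSets N w + missingBelow N T a)
    ≡⟨ regroup₂ (inv0 w) (holes w) above (invSets N w) _ ⟩
  inv0 w + invSets N w + (holes w + missingBelow N T a) + above ∎)
  where
  open ≡-Reasoning
  T = numerals w
  above = countB (a <ᵇ_) T
  regroup₁ : ∀ i h c x → i + (h + c) + x + c ≡ i + h + c + (x + c)
  regroup₁ = solve-∀
  regroup₂ : ∀ i h c x t → i + h + c + (x + t) ≡ i + x + (h + t) + c
  regroup₂ = solve-∀

isRlmin-suc : ∀ N T → isRlmin T (suc N) ≡ (missing N T ≡ᵇ 0)
isRlmin-suc N T = all≡countB-not≡ᵇ0 (λ b → elemℕ b T) (range1 N)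

missing-suc : ∀ N T → missing (suc N) T ≡ missing N T + ind (not (elemℕ (suc N) T))
missing-suc N T = trans (cong (countB (λ b → not (elemℕ b T))) (range1-suc N)) (countB-∷ʳ _ (range1 N) (suc N))

missingBelow-suc : ∀ N T {a} → a ≤ N → missingBelow (suc N) T a ≡ missingBelow N T a
missingBelow-suc N T {a} a≤N = begin
  countB g (range1 (suc N))                                  ≡⟨ cong (countB g) (range1-suc N) ⟩
  countB g (range1 N ∷ʳ suc N)                               ≡⟨ countB-∷ʳ g (range1 N) (suc N) ⟩
  missingBelow N T a + ind (not (elemℕ (suc N) T) ∧ (suc N <ᵇ a))
    ≡⟨ cong (λ e → missingBelow N T a + ind (not (elemℕ (suc N) T) ∧ e)) (≥⇒<ᵇ-false (m≤n⇒m≤1+n a≤N)) ⟩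
  missingBelow N T a + ind (not (elemℕ (suc N) T) ∧ false)   ≡⟨ cong (λ e → missingBelow N T a + ind e) (∧-zeroʳ _) ⟩
  missingBelow N T a + 0                                     ≡⟨ +-identityʳ _ ⟩
  missingBelow N T a                                         ∎
  where open ≡-Reasoning
        g = λ b → not (elemℕ b T) ∧ (b <ᵇ a)

missingBelow-above : ∀ N T → missingBelow N T (suc N) ≡ missing N T
missingBelow-above N T = countB-cong-All (range1-InRange N)
  (λ b (_ , b≤N) → trans (cong (not (elemℕ b T) ∧_) (<⇒<ᵇ-true (s≤s b≤N))) (∧-identityʳ _))

missingBelow-top : ∀ N T → missingBelow (suc N) T (suc N) ≡ missing N T
missingBelow-top N T = begin
  countB g (range1 (suc N))                                          ≡⟨ cong (countB g) (range1-suc N) ⟩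
  countB g (range1 N ∷ʳ suc N)                                       ≡⟨ countB-∷ʳ g (range1 N) (suc N) ⟩
  missingBelow N T (suc N) + ind (not (elemℕ (suc N) T) ∧ (suc N <ᵇ suc N))
    ≡⟨ cong₂ (λ x e → x + ind (not (elemℕ (suc N) T) ∧ e)) (missingBelow-above N T) (≥⇒<ᵇ-false (≤-refl {suc N})) ⟩
  missing N T + ind (not (elemℕ (suc N) T) ∧ false)                  ≡⟨ cong (λ e → missing N T + ind e) (∧-zeroʳ _) ⟩
  missing N T + 0                                                    ≡⟨ +-identityʳ _ ⟩
  missing N T                                                        ∎
  where open ≡-Reasoning
        g = λ b → not (elemℕ b T) ∧ (b <ᵇ suc N)

module InvGF (β q : ℕ) where
  open QNumbers β q

  newNumeralWeight : ℕ → List ℕ → ℕ → ℕ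
  newNumeralWeight N T a = if not (elemℕ a T) then βif (isRlmin T a) * q ^ missingBelow N T a else 0

  -- The values missing from T have ranks 0, 1, …, c-1 among themselves, and only rank 0 is a new minimum.
  ∑-newNumeralWeight : ∀ N T → ∑ (range1 N) (newNumeralWeight N T) ≡ βqnum (missing N T)
  ∑-newNumeralWeight zero    T = refl
  ∑-newNumeralWeight (suc N) T = begin
    ∑ (range1 (suc N)) (newNumeralWeight (suc N) T)
      ≡⟨ cong (λ xs → ∑ xs (newNumeralWeight (suc N) T)) (range1-suc N) ⟩
    ∑ (range1 N ∷ʳ suc N) (newNumeralWeight (suc N) T)
      ≡⟨ ∑-∷ʳ (range1 N) (suc N) (newNumeralWeight (suc N) T) ⟩
    ∑ (range1 N) (newNumeralWeight (suc N) T) + newNumeralWeight (suc N) T (suc N)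
      ≡⟨ cong₂ _+_ (trans (∑-cong-All (range1-InRange N) (λ a (_ , a≤N) → cong (λ m → if not (elemℕ a T) then βif (isRlmin T a) * q ^ m else 0) (missingBelow-suc N T a≤N)))
                          (∑-newNumeralWeight N T))
                   (cong₂ (λ r m → if not (elemℕ (suc N) T) then βif r * q ^ m else 0) (isRlmin-suc N T) (missingBelow-top N T)) ⟩
    βqnum c + (if not (elemℕ (suc N) T) then βif (c ≡ᵇ 0) * q ^ c else 0)
      ≡⟨ addTop (elemℕ (suc N) T) ⟩
    βqnum (c + ind (not (elemℕ (suc N) T)))
      ≡⟨ cong βqnum (sym (missing-suc N T)) ⟩
    βqnum (missing (suc N) T) ∎
    where
    open ≡-Reasoning
    c = missing N T
    addTop : ∀ e → βqnum c + (if not e then βif (c ≡ᵇ 0) * q ^ c else 0) ≡ βqnum (c + ind (not e))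
    addTop true  = trans (+-identityʳ _) (cong βqnum (sym (+-identityʳ c)))
    addTop false = trans (sym (βqnum-suc c)) (cong βqnum (+-comm 1 c))

  weightInv : ℕ → Word → ℕ
  weightInv N w = β ^ rlmin w * q ^ inv N w

  termInv : ℕ → ℕ → Word → ℕ
  termInv N k w = if isPartialPerm k w then weightInv N w else 0

  Finv : ℕ → ℕ → ℕ → ℕ
  Finv N L k = ∑ (allWords N L) (termInv N k)

  termInv-∷ʳ-hole : ∀ N k w → termInv N k (w ∷ʳ nothing) ≡ (if (suc (holes w) ≡ᵇ k) ∧ noDup (numerals w) then weightInv N w else 0)
  termInv-∷ʳ-hole N k w = cong₂ (λ b x → if b then x else 0) (isPartialPerm-∷ʳ-hole k w)
    (cong₂ (λ r i → β ^ r * q ^ i) (trans (rlmin-∷ʳ [] w nothing) (+-identityʳ _)) (inv-∷ʳ-hole N w))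

  termInv-∷ʳ : ∀ N k w {a} → InRange N a →
    termInv N k (w ∷ʳ just a) ≡ (if isPartialPerm k w then weightInv N w * (q ^ k * newNumeralWeight N (numerals w) a) else 0)
  termInv-∷ʳ N k w {a} a∈N rewrite isPartialPerm-∷ʳ k w a with isPartialPerm k w in pp | elemℕ a (numerals w) in a∉w
  ... | false | _     = refl
  ... | true  | true  = sym (trans (cong (weightInv N w *_) (*-zeroʳ (q ^ k))) (*-zeroʳ (weightInv N w)))
  ... | true  | false = begin
    β ^ rlmin (w ∷ʳ just a) * q ^ inv N (w ∷ʳ just a)
      ≡⟨ cong₂ (λ r i → β ^ r * q ^ i) (rlmin-∷ʳ [] w (just a)) (inv-∷ʳ w a∈N a∉w) ⟩
    β ^ (rlmin w + ind r) * q ^ (inv N w + (holes w + m))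
      ≡⟨ cong (λ h → β ^ (rlmin w + ind r) * q ^ (inv N w + (h + m))) (isPartialPerm⇒holes k w pp) ⟩
    β ^ (rlmin w + ind r) * q ^ (inv N w + (k + m))
      ≡⟨ cong₂ _*_ (^-distribˡ-+-* β (rlmin w) (ind r)) (trans (q^-+ (inv N w) _) (cong (q ^ inv N w *_) (q^-+ k m))) ⟩
    β ^ rlmin w * β ^ ind r * (q ^ inv N w * (q ^ k * q ^ m))
      ≡⟨ cong (λ x → β ^ rlmin w * x * (q ^ inv N w * (q ^ k * q ^ m))) (β^ind≡βif r) ⟩
    β ^ rlmin w * βif r * (q ^ inv N w * (q ^ k * q ^ m))
      ≡⟨ regroup (β ^ rlmin w) (βif r) (q ^ inv N w) (q ^ k) (q ^ m) ⟩
    weightInv N w * (q ^ k * (βif r * q ^ m)) ∎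
    where
    open ≡-Reasoning
    r = isRlmin (numerals w) a
    m = missingBelow N (numerals w) a
    regroup : ∀ a b c d e → a * b * (c * (d * e)) ≡ a * c * (d * (b * e))
    regroup = solve-∀

  ∑-termInv-∷ʳ : ∀ N k w → ∑[ a ∈ range1 N ] termInv N k (w ∷ʳ just a)
                           ≡ (if isPartialPerm k w then weightInv N w * (q ^ k * βqnum (missing N (numerals w))) else 0)
  ∑-termInv-∷ʳ N k w = trans (∑-cong-All (range1-InRange N) (λ a a∈N → termInv-∷ʳ N k w a∈N)) (split (isPartialPerm k w))
    where
    split : ∀ b → ∑[ a ∈ range1 N ] (if b then weightInv N w * (q ^ k * newNumeralWeight N (numerals w) a) else 0)
                  ≡ (if b then weightInv N w * (q ^ k * βqnum (missing N (numerals w))) else 0)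
    split false = ∑-zero (range1 N)
    split true  = trans (∑-*ˡ (range1 N) (weightInv N w) _) (cong (weightInv N w *_)
                    (trans (∑-*ˡ (range1 N) (q ^ k) _) (cong (q ^ k *_) (∑-newNumeralWeight N (numerals w)))))

  Finv-suc : ∀ N L k → Finv N (suc L) k ≡ ∑[ w ∈ allWords N L ] termInv N k (w ∷ʳ nothing) + q ^ k * βqnum (N ∸ (L ∸ k)) * Finv N L k
  Finv-suc N L k = begin
    Finv N (suc L) k
      ≡⟨ ∑-allWords-∷ʳ N L (termInv N k) ⟩
    ∑[ w ∈ allWords N L ] ∑[ x ∈ letters N ] termInv N k (w ∷ʳ x)
      ≡⟨ ∑-cong (allWords N L) (λ w → trans (∑-letters N (λ x → termInv N k (w ∷ʳ x))) (cong (termInv N k (w ∷ʳ nothing) +_) (∑-termInv-∷ʳ N k w))) ⟩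
    ∑[ w ∈ allWords N L ] (termInv N k (w ∷ʳ nothing) + numeralPart w)
      ≡⟨ ∑-+ (allWords N L) _ numeralPart ⟩
    ∑[ w ∈ allWords N L ] termInv N k (w ∷ʳ nothing) + ∑ (allWords N L) numeralPart
      ≡⟨ cong (∑[ w ∈ allWords N L ] termInv N k (w ∷ʳ nothing) +_)
              (trans (∑-cong-All (allWords-WordOver N L) (λ w w∈ → fixMissing w w∈ (isPartialPerm k w) refl))
                     (∑-*ˡ (allWords N L) (q ^ k * βqnum c) (termInv N k))) ⟩
    ∑[ w ∈ allWords N L ] termInv N k (w ∷ʳ nothing) + q ^ k * βqnum c * Finv N L k ∎
    where
    open ≡-Reasoning
    c = N ∸ (L ∸ k)
    numeralPart : Word → ℕ
    numeralPart w = if isPartialPerm k w then weightInv N w * (q ^ k * βqnum (missing N (numerals w))) else 0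
    fixMissing : ∀ w → WordOver N L w → ∀ b → isPartialPerm k w ≡ b →
                 (if b then weightInv N w * (q ^ k * βqnum (missing N (numerals w))) else 0) ≡ q ^ k * βqnum c * (if b then weightInv N w else 0)
    fixMissing w w∈ false _  = sym (*-zeroʳ (q ^ k * βqnum c))
    fixMissing w w∈ true  pp = trans (cong (λ m → weightInv N w * (q ^ k * βqnum m)) (isPartialPerm⇒missing w w∈ pp)) (*-comm (weightInv N w) _)

  Finv-closed : ∀ N L k → Finv N L k ≡ qbin L k * βqfall N (L ∸ k)
  Finv-closed N zero    zero    = refl
  Finv-closed N zero    (suc k) = refl
  Finv-closed N (suc L) zero    = begin
    Finv N (suc L) 0
      ≡⟨ Finv-suc N L 0 ⟩
    ∑[ w ∈ allWords N L ] termInv N 0 (w ∷ʳ nothing) + 1 * βqnum (N ∸ L) * Finv N L 0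
      ≡⟨ cong₂ (λ x y → x + 1 * βqnum (N ∸ L) * y)
               (trans (∑-cong (allWords N L) (termInv-∷ʳ-hole N 0)) (∑-zero (allWords N L))) (Finv-closed N L 0) ⟩
    1 * βqnum (N ∸ L) * (qbin L 0 * βqfall N L)               ≡⟨ cong (λ x → 1 * βqnum (N ∸ L) * (x * βqfall N L)) (qbin-zero L) ⟩
    1 * βqnum (N ∸ L) * (1 * βqfall N L)                      ≡⟨ cong₂ _*_ (*-identityˡ (βqnum (N ∸ L))) (*-identityˡ (βqfall N L)) ⟩
    βqnum (N ∸ L) * βqfall N L                                ≡⟨ sym (βqfall-suc N L) ⟩
    βqfall N (suc L)                                          ≡⟨ sym (*-identityˡ _) ⟩
    qbin (suc L) 0 * βqfall N (suc L)                         ∎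
    where open ≡-Reasoning
  Finv-closed N (suc L) (suc k) = begin
    Finv N (suc L) (suc k)
      ≡⟨ Finv-suc N L (suc k) ⟩
    ∑[ w ∈ allWords N L ] termInv N (suc k) (w ∷ʳ nothing) + q ^ suc k * βqnum (N ∸ (L ∸ suc k)) * Finv N L (suc k)
      ≡⟨ cong₂ (λ x y → x + q ^ suc k * βqnum (N ∸ (L ∸ suc k)) * y) (∑-cong (allWords N L) (termInv-∷ʳ-hole N (suc k))) (Finv-closed N L (suc k)) ⟩
    Finv N L k + q ^ suc k * βqnum (N ∸ (L ∸ suc k)) * (qbin L (suc k) * βqfall N (L ∸ suc k))
      ≡⟨ cong₂ _+_ (Finv-closed N L k) (trans (*-assoc (q ^ suc k) _ _) (cong (q ^ suc k *_) (sym (qbin-βqfall-suc N L (suc k))))) ⟩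
    qbin L k * βqfall N (L ∸ k) + q ^ suc k * (qbin L (suc k) * βqfall N (L ∸ k))
      ≡⟨ cong (qbin L k * βqfall N (L ∸ k) +_) (sym (*-assoc (q ^ suc k) _ _)) ⟩
    qbin L k * βqfall N (L ∸ k) + q ^ suc k * qbin L (suc k) * βqfall N (L ∸ k)
      ≡⟨ sym (*-distribʳ-+ (βqfall N (L ∸ k)) (qbin L k) _) ⟩
    qbin (suc L) (suc k) * βqfall N (suc L ∸ suc k) ∎
    where open ≡-Reasoning

  sumRlminInv≡qbin*βqfall : ∀ n k → sumRlminInv n k β q ≡ qbin n k * βqfall n (n ∸ k)
  sumRlminInv≡qbin*βqfall n k = trans (∑-filter (isPartialPerm k) (allWords n n) (weightInv n)) (Finv-closed n n k)

-- Inserting a new largest value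
insertAt : ℕ → Letter → Word → Word
insertAt zero    z u       = z ∷ u
insertAt (suc p) z []      = z ∷ []
insertAt (suc p) z (y ∷ u) = y ∷ insertAt p z u

insertAt-∷ʳ : ∀ {p} z u y → p ≤ length u → insertAt p z (u ∷ʳ y) ≡ insertAt p z u ∷ʳ y
insertAt-∷ʳ {zero}  z u       y _         = refl
insertAt-∷ʳ {suc p} z (a ∷ u) y (s≤s p≤u) = cong (a ∷_) (insertAt-∷ʳ z u y p≤u)

insertAt-length : ∀ z u → insertAt (length u) z u ≡ u ∷ʳ z
insertAt-length z []      = refl
insertAt-length z (a ∷ u) = cong (a ∷_) (insertAt-length z u)

length-insertAt : ∀ p z u → length (insertAt p z u) ≡ suc (length u)
length-insertAt zero    z u       = refl
length-insertAt (suc p) z []      = refl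
length-insertAt (suc p) z (a ∷ u) = cong suc (length-insertAt p z u)

lastExceeds-insertAt : ∀ {p} z u y → p < length u → lastExceeds (insertAt p z u) y ≡ lastExceeds u y
lastExceeds-insertAt {zero}        z (a ∷ u)     y _        = refl
lastExceeds-insertAt {suc zero}    z (a ∷ b ∷ u) y _        = refl
lastExceeds-insertAt {suc zero}    z (a ∷ [])    y (s≤s ())
lastExceeds-insertAt {suc (suc p)} z (a ∷ b ∷ u) y (s≤s p<) = lastExceeds-insertAt z (b ∷ u) y p<

countB-insertAt : ∀ (f : Letter → Bool) p z u → countB f (insertAt p z u) ≡ ind (f z) + countB f u
countB-insertAt f zero    z u       = refl
countB-insertAt f (suc p) z []      = refl
countB-insertAt f (suc p) z (a ∷ u) =
  trans (cong (ind (f a) +_) (countB-insertAt f p z u)) (+-CS.x∙yz≈y∙xz (ind (f a)) (ind (f z)) (countB f u))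

elemℕ-numerals-insertAt : ∀ b p z u → elemℕ b (numerals (insertAt p (just z) u)) ≡ (b ≡ᵇ z) ∨ elemℕ b (numerals u)
elemℕ-numerals-insertAt b zero    z u             = refl
elemℕ-numerals-insertAt b (suc p) z []            = refl
elemℕ-numerals-insertAt b (suc p) z (nothing ∷ u) = elemℕ-numerals-insertAt b p z u
elemℕ-numerals-insertAt b (suc p) z (just a ∷ u)  =
  trans (cong ((b ≡ᵇ a) ∨_) (elemℕ-numerals-insertAt b p z u)) (swap (b ≡ᵇ a) (b ≡ᵇ z) _)
  where
  swap : ∀ x y r → x ∨ (y ∨ r) ≡ y ∨ (x ∨ r)
  swap true  true  r = refl
  swap true  false r = refl
  swap false y     r = refl

noDup-numerals-insertAt : ∀ p z u → noDup (numerals (insertAt p (just z) u)) ≡ not (elemℕ z (numerals u)) ∧ noDup (numerals u)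
noDup-numerals-insertAt zero    z u             = refl
noDup-numerals-insertAt (suc p) z []            = refl
noDup-numerals-insertAt (suc p) z (nothing ∷ u) = noDup-numerals-insertAt p z u
noDup-numerals-insertAt (suc p) z (just a ∷ u)  = begin
  not (elemℕ a (numerals (insertAt p (just z) u))) ∧ noDup (numerals (insertAt p (just z) u))
    ≡⟨ cong₂ (λ x y → not x ∧ y) (elemℕ-numerals-insertAt a p z u) (noDup-numerals-insertAt p z u) ⟩
  not ((a ≡ᵇ z) ∨ elemℕ a T) ∧ (not (elemℕ z T) ∧ noDup T)
    ≡⟨ swap (a ≡ᵇ z) (elemℕ a T) (elemℕ z T) (noDup T) ⟩
  not ((a ≡ᵇ z) ∨ elemℕ z T) ∧ (not (elemℕ a T) ∧ noDup T)
    ≡⟨ cong (λ e → not (e ∨ elemℕ z T) ∧ (not (elemℕ a T) ∧ noDup T)) (≡ᵇ-sym a z) ⟩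
  not ((z ≡ᵇ a) ∨ elemℕ z T) ∧ (not (elemℕ a T) ∧ noDup T) ∎
  where
  open ≡-Reasoning
  T = numerals u
  swap : ∀ e x y d → not (e ∨ x) ∧ (not y ∧ d) ≡ not (e ∨ y) ∧ (not x ∧ d)
  swap true  x     y     d = refl
  swap false true  true  d = refl
  swap false true  false d = refl
  swap false false y     d = refl

∑-numerals-insertAt : ∀ (f : ℕ → ℕ) p z u → ∑ (numerals (insertAt p (just z) u)) f ≡ f z + ∑ (numerals u) f
∑-numerals-insertAt f zero    z u             = refl
∑-numerals-insertAt f (suc p) z []            = refl
∑-numerals-insertAt f (suc p) z (nothing ∷ u) = ∑-numerals-insertAt f p z u
∑-numerals-insertAt f (suc p) z (just a ∷ u)  =
  trans (cong (f a +_) (∑-numerals-insertAt f p z u)) (+-CS.x∙yz≈y∙xz (f a) (f z) _)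

elemℕ-top : ∀ {N} (T : List ℕ) → All (InRange N) T → elemℕ (suc N) T ≡ false
elemℕ-top []      []                = refl
elemℕ-top (a ∷ T) ((_ , a≤N) ∷ T⊆N) = cong₂ _∨_ (>⇒≢ᵇ (s≤s a≤N)) (elemℕ-top T T⊆N)

rlminAux-cong : ∀ {N} pre₁ pre₂ u → (∀ b → b ≤ N → elemℕ b (numerals pre₁) ≡ elemℕ b (numerals pre₂)) →
                All (LetterOf N) u → rlminAux pre₁ u ≡ rlminAux pre₂ u
rlminAux-cong pre₁ pre₂ []            same []        = refl
rlminAux-cong pre₁ pre₂ (nothing ∷ u) same (_ ∷ pu) = rlminAux-cong (pre₁ ∷ʳ nothing) (pre₂ ∷ʳ nothing) u
  (λ b b≤N → trans (cong (elemℕ b) (numerals-∷ʳ-hole pre₁)) (trans (same b b≤N) (cong (elemℕ b) (sym (numerals-∷ʳ-hole pre₂))))) pu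
rlminAux-cong {N} pre₁ pre₂ (just a ∷ u)  same ((_ , a≤N) ∷ pu) = cong₂ _+_
  (cong ind (all-cong-All (range1-InRange (a ∸ 1)) (λ b (_ , b<a) → same b (≤-trans b<a (≤-trans (m∸n≤m a 1) a≤N)))))
  (rlminAux-cong (pre₁ ∷ʳ just a) (pre₂ ∷ʳ just a) u same′ pu)
  where
  elem-∷ʳ : ∀ pre b → elemℕ b (numerals (pre ∷ʳ just a)) ≡ elemℕ b (numerals pre) ∨ (b ≡ᵇ a)
  elem-∷ʳ pre b = trans (cong (elemℕ b) (numerals-∷ʳ pre a)) (elemℕ-∷ʳ b (numerals pre) a)
  same′ : ∀ b → b ≤ N → elemℕ b (numerals (pre₁ ∷ʳ just a)) ≡ elemℕ b (numerals (pre₂ ∷ʳ just a))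
  same′ b b≤N = trans (elem-∷ʳ pre₁ b) (trans (cong (_∨ (b ≡ᵇ a)) (same b b≤N)) (sym (elem-∷ʳ pre₂ b)))

rlmin-insertAt : ∀ {N} pre p u → All (LetterOf N) u →
  rlminAux pre (insertAt p (just (suc N)) u) ≡ rlminAux pre u + ind (isRlmin (numerals (pre ++ take p u)) (suc N))
rlmin-insertAt {N} pre zero    u pu = begin
  top pre + rlminAux (pre ∷ʳ just (suc N)) u ≡⟨ cong (top pre +_) (rlminAux-cong (pre ∷ʳ just (suc N)) pre u ignoreTop pu) ⟩
  top pre + rlminAux pre u                   ≡⟨ +-comm (top pre) _ ⟩
  rlminAux pre u + top pre                   ≡⟨ cong (λ p → rlminAux pre u + top p) (sym (++-identityʳ pre)) ⟩
  rlminAux pre u + top (pre ++ [])           ∎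
  where
  open ≡-Reasoning
  top = λ pre → ind (isRlmin (numerals pre) (suc N))
  ignoreTop : ∀ b → b ≤ N → elemℕ b (numerals (pre ∷ʳ just (suc N))) ≡ elemℕ b (numerals pre)
  ignoreTop b b≤N = trans (cong (elemℕ b) (numerals-∷ʳ pre (suc N)))
                          (trans (elemℕ-∷ʳ b (numerals pre) (suc N)) (trans (cong (elemℕ b (numerals pre) ∨_) (<⇒≢ᵇ (s≤s b≤N))) (∨-identityʳ _)))
rlmin-insertAt {N} pre (suc p) []            []       = rlmin-insertAt {N} pre zero [] []
rlmin-insertAt {N} pre (suc p) (nothing ∷ u) (_ ∷ pu) = trans (rlmin-insertAt (pre ∷ʳ nothing) p u pu)
  (cong (λ w → rlminAux (pre ∷ʳ nothing) u + ind (isRlmin (numerals w) (suc N))) (++-assoc pre [ nothing ] (take p u)))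
rlmin-insertAt {N} pre (suc p) (just a ∷ u)  (_ ∷ pu) = begin
  r + rlminAux (pre ∷ʳ just a) (insertAt p Z u)
    ≡⟨ cong (r +_) (rlmin-insertAt (pre ∷ʳ just a) p u pu) ⟩
  r + (rlminAux (pre ∷ʳ just a) u + top ((pre ∷ʳ just a) ++ take p u))
    ≡⟨ sym (+-assoc r _ _) ⟩
  r + rlminAux (pre ∷ʳ just a) u + top ((pre ∷ʳ just a) ++ take p u)
    ≡⟨ cong (λ w → r + rlminAux (pre ∷ʳ just a) u + top w) (++-assoc pre [ just a ] (take p u)) ⟩
  r + rlminAux (pre ∷ʳ just a) u + top (pre ++ just a ∷ take p u) ∎
  where
  open ≡-Reasoning
  Z = just (suc N)
  r = rlminAt pre (just a)
  top = λ pre → ind (isRlmin (numerals pre) (suc N))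

invSets-lift : ∀ {N} (w : Word) → All (LetterOf N) w → invSets (suc N) w ≡ invSets N w
invSets-lift {N} w pw = ∑-cong-All (numerals-InRange w pw) (λ a (_ , a≤N) → missingBelow-suc N (numerals w) a≤N)

invSets-insertAt : ∀ {N} p (u : Word) → All (LetterOf N) u →
                   invSets (suc N) (insertAt p (just (suc N)) u) ≡ invSets N u + missing N (numerals u)
invSets-insertAt {N} p u pu = begin
  ∑ T′ (missingBelow (suc N) T′)
    ≡⟨ ∑-cong T′ (λ a → countB-cong (range1 (suc N)) (λ b → cong (λ e → not e ∧ (b <ᵇ a)) (elemℕ-numerals-insertAt b p (suc N) u))) ⟩
  ∑ T′ h
    ≡⟨ ∑-numerals-insertAt h p (suc N) u ⟩
  h (suc N) + ∑ T h
    ≡⟨ cong₂ _+_ (trans (h≡missingBelow (suc N)) (missingBelow-above N T)) (∑-cong T h≡missingBelow) ⟩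
  missing N T + invSets N u
    ≡⟨ +-comm (missing N T) _ ⟩
  invSets N u + missing N T ∎
  where
  open ≡-Reasoning
  T = numerals u
  T′ = numerals (insertAt p (just (suc N)) u)
  h = λ a → countB (λ b → not ((b ≡ᵇ suc N) ∨ elemℕ b T) ∧ (b <ᵇ a)) (range1 (suc N))
  h≡missingBelow : ∀ a → h a ≡ missingBelow N T a
  h≡missingBelow a = begin
    h a
      ≡⟨ cong (countB _) (range1-suc N) ⟩
    countB (λ b → not ((b ≡ᵇ suc N) ∨ elemℕ b T) ∧ (b <ᵇ a)) (range1 N ∷ʳ suc N)
      ≡⟨ countB-∷ʳ _ (range1 N) (suc N) ⟩
    countB (λ b → not ((b ≡ᵇ suc N) ∨ elemℕ b T) ∧ (b <ᵇ a)) (range1 N) + ind (not ((suc N ≡ᵇ suc N) ∨ elemℕ (suc N) T) ∧ (suc N <ᵇ a))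
      ≡⟨ cong₂ _+_ (countB-cong-All (range1-InRange N) (λ b (_ , b≤N) → cong (λ e → not (e ∨ elemℕ b T) ∧ (b <ᵇ a)) (<⇒≢ᵇ (s≤s b≤N))))
                   (cong (λ e → ind (not (e ∨ elemℕ (suc N) T) ∧ (suc N <ᵇ a))) (≡ᵇ-refl N)) ⟩
    missingBelow N T a + 0
      ≡⟨ +-identityʳ _ ⟩
    missingBelow N T a ∎

isValue : ℕ → Letter → Bool
isValue z nothing  = false
isValue z (just a) = a ≡ᵇ z

occurrences : ℕ → Word → ℕ
occurrences z = countB (isValue z)

occurs⇒elemℕ : ∀ z w → 1 ≤ occurrences z w → elemℕ z (numerals w) ≡ true
occurs⇒elemℕ z (nothing ∷ w) occ = occurs⇒elemℕ z w occ
occurs⇒elemℕ z (just a ∷ w)  occ with a ≡ᵇ z in a≡z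
... | true  = cong (_∨ elemℕ z (numerals w)) (trans (≡ᵇ-sym z a) a≡z)
... | false = trans (cong (_∨ elemℕ z (numerals w)) (trans (≡ᵇ-sym z a) a≡z)) (occurs⇒elemℕ z w occ)

occursTwice⇒¬noDup : ∀ z w → 2 ≤ occurrences z w → noDup (numerals w) ≡ false
occursTwice⇒¬noDup z (nothing ∷ w) occ = occursTwice⇒¬noDup z w occ
occursTwice⇒¬noDup z (just a ∷ w)  occ with a ≡ᵇ z in a≡z
... | true with ≡ᵇ-true⇒≡ a z a≡z
...   | refl = cong (λ e → not e ∧ noDup (numerals w)) (occurs⇒elemℕ a w (≤-pred occ))
occursTwice⇒¬noDup z (just a ∷ w) occ | false =
  trans (cong (not (elemℕ a (numerals w)) ∧_) (occursTwice⇒¬noDup z w occ)) (∧-zeroʳ _)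

occurrences-∷ : ∀ z x w → occurrences z w ≤ occurrences z (x ∷ w)
occurrences-∷ z x w = m≤n+m (occurrences z w) (ind (isValue z x))

occurrences-∷-self : ∀ N w → occurrences (suc N) (just (suc N) ∷ w) ≡ suc (occurrences (suc N) w)
occurrences-∷-self N w = cong (λ e → ind e + occurrences (suc N) w) (≡ᵇ-refl N)

∑-allWords-avoiding : ∀ N L (h : Word → ℕ) → (∀ w → 1 ≤ occurrences (suc N) w → h w ≡ 0) →
                      ∑ (allWords (suc N) L) h ≡ ∑ (allWords N L) h
∑-allWords-avoiding N zero    h avoid = refl
∑-allWords-avoiding N (suc L) h avoid = begin
  ∑ (allWords (suc N) (suc L)) h
    ≡⟨ ∑-allWords-suc (suc N) L h ⟩
  ∑[ x ∈ letters (suc N) ] ∑[ w ∈ allWords (suc N) L ] h (x ∷ w)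
    ≡⟨ ∑-letters-suc N (λ x → ∑[ w ∈ allWords (suc N) L ] h (x ∷ w)) ⟩
  ∑[ x ∈ letters N ] ∑[ w ∈ allWords (suc N) L ] h (x ∷ w) + ∑[ w ∈ allWords (suc N) L ] h (Z ∷ w)
    ≡⟨ cong₂ _+_ (∑-cong (letters N) (λ x → ∑-allWords-avoiding N L (λ w → h (x ∷ w)) (λ w occ → avoid (x ∷ w) (≤-trans occ (occurrences-∷ (suc N) x w)))))
                 (trans (∑-cong (allWords (suc N) L) (λ w → avoid (Z ∷ w) (subst (1 ≤_) (sym (occurrences-∷-self N w)) (s≤s z≤n))))
                        (∑-zero (allWords (suc N) L))) ⟩
  ∑[ x ∈ letters N ] ∑[ w ∈ allWords N L ] h (x ∷ w) + 0
    ≡⟨ +-identityʳ _ ⟩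
  ∑[ x ∈ letters N ] ∑[ w ∈ allWords N L ] h (x ∷ w)
    ≡⟨ sym (∑-allWords-suc N L h) ⟩
  ∑ (allWords N (suc L)) h ∎
  where open ≡-Reasoning
        Z = just (suc N)

-- A word over [N+1] in which N+1 occurs at most once either avoids N+1 or arises,
-- in exactly one way, by inserting N+1 into a word over [N].
∑-allWords-insertTop : ∀ N L (g : Word → ℕ) → (∀ w → 2 ≤ occurrences (suc N) w → g w ≡ 0) →
  ∑ (allWords (suc N) (suc L)) g ≡ ∑ (allWords N (suc L)) g + ∑[ u ∈ allWords N L ] ∑[ p ∈ upTo (suc L) ] g (insertAt p (just (suc N)) u)
∑-allWords-insertTop N zero    g once = begin
  ∑ (allWords (suc N) 1) g                                     ≡⟨ ∑-allWords-suc (suc N) 0 g ⟩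
  ∑[ x ∈ letters (suc N) ] (g (x ∷ []) + 0)                    ≡⟨ ∑-letters-suc N (λ x → g (x ∷ []) + 0) ⟩
  ∑[ x ∈ letters N ] (g (x ∷ []) + 0) + (g (Z ∷ []) + 0)        ≡⟨ cong (_+ (g (Z ∷ []) + 0)) (sym (∑-allWords-suc N 0 g)) ⟩
  ∑ (allWords N 1) g + (g (Z ∷ []) + 0)                        ≡⟨ cong (∑ (allWords N 1) g +_) (sym (+-identityʳ _)) ⟩
  ∑ (allWords N 1) g + (g (Z ∷ []) + 0 + 0)                    ∎
  where open ≡-Reasoning
        Z = just (suc N)
∑-allWords-insertTop N (suc L) g once = begin
  ∑ (allWords (suc N) (suc (suc L))) g
    ≡⟨ ∑-allWords-suc (suc N) (suc L) g ⟩
  ∑[ x ∈ letters (suc N) ] ∑[ w ∈ allWords (suc N) (suc L) ] g (x ∷ w)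
    ≡⟨ ∑-letters-suc N (λ x → ∑[ w ∈ allWords (suc N) (suc L) ] g (x ∷ w)) ⟩
  ∑[ x ∈ letters N ] ∑[ w ∈ allWords (suc N) (suc L) ] g (x ∷ w) + ∑[ w ∈ allWords (suc N) (suc L) ] g (Z ∷ w)
    ≡⟨ cong₂ _+_ (∑-cong (letters N) (λ x → ∑-allWords-insertTop N L (λ w → g (x ∷ w)) (λ w occ → once (x ∷ w) (≤-trans occ (occurrences-∷ (suc N) x w)))))
                 (∑-allWords-avoiding N (suc L) (λ w → g (Z ∷ w)) (λ w occ → once (Z ∷ w) (subst (2 ≤_) (sym (occurrences-∷-self N w)) (s≤s occ)))) ⟩
  ∑[ x ∈ letters N ] (∑[ w ∈ allWords N (suc L) ] g (x ∷ w) + inserted x) + ∑[ w ∈ allWords N (suc L) ] g (Z ∷ w)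
    ≡⟨ cong₂ _+_ (∑-+ (letters N) _ inserted) (∑-allWords-suc N L (λ w → g (Z ∷ w))) ⟩
  A + ∑ (letters N) inserted + ∑[ x ∈ letters N ] ∑[ u ∈ allWords N L ] g (Z ∷ x ∷ u)
    ≡⟨ +-assoc A _ _ ⟩
  A + (∑ (letters N) inserted + ∑[ x ∈ letters N ] ∑[ u ∈ allWords N L ] g (Z ∷ x ∷ u))
    ≡⟨ cong₂ _+_ (sym (∑-allWords-suc N (suc L) g)) (+-comm (∑ (letters N) inserted) _) ⟩
  ∑ (allWords N (suc (suc L))) g + (∑[ x ∈ letters N ] ∑[ u ∈ allWords N L ] g (Z ∷ x ∷ u) + ∑ (letters N) inserted)
    ≡⟨ cong (∑ (allWords N (suc (suc L))) g +_) (sym (∑-+ (letters N) _ inserted)) ⟩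
  ∑ (allWords N (suc (suc L))) g + ∑[ x ∈ letters N ] (∑[ u ∈ allWords N L ] g (Z ∷ x ∷ u) + inserted x)
    ≡⟨ cong (∑ (allWords N (suc (suc L))) g +_) (∑-cong (letters N) (λ x → sym (trans (∑-cong (allWords N L) (λ u → ∑-upTo-sucˡ (suc L) (λ p → g (insertAt p Z (x ∷ u)))))
                                                                                       (∑-+ (allWords N L) (λ u → g (Z ∷ x ∷ u)) _)))) ⟩
  ∑ (allWords N (suc (suc L))) g + ∑[ x ∈ letters N ] ∑[ u ∈ allWords N L ] ∑[ p ∈ upTo (suc (suc L)) ] g (insertAt p Z (x ∷ u))
    ≡⟨ cong (∑ (allWords N (suc (suc L))) g +_) (sym (∑-allWords-suc N L (λ u → ∑[ p ∈ upTo (suc (suc L)) ] g (insertAt p Z u)))) ⟩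
  ∑ (allWords N (suc (suc L))) g + ∑[ u ∈ allWords N (suc L) ] ∑[ p ∈ upTo (suc (suc L)) ] g (insertAt p Z u) ∎
  where
  open ≡-Reasoning
  Z = just (suc N)
  inserted : Letter → ℕ
  inserted x = ∑[ u ∈ allWords N L ] ∑[ p ∈ upTo (suc L) ] g (x ∷ insertAt p Z u)
  A = ∑[ x ∈ letters N ] ∑[ w ∈ allWords N (suc L) ] g (x ∷ w)

top-exceeds : ∀ {N} y → LetterOf N y → (just (suc N) >ᴸ y) ≡ not (isHole y)
top-exceeds nothing  _         = refl
top-exceeds (just c) (_ , c≤N) = <⇒<ᵇ-true (s≤s c≤N)

exceeds-top : ∀ {N} y → LetterOf N y → (y >ᴸ just (suc N)) ≡ isHole y
exceeds-top nothing  _         = refl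
exceeds-top (just c) (_ , c≤N) = ≥⇒<ᵇ-false (m≤n⇒m≤1+n c≤N)

lastExceeds-top : ∀ {N} u c → All (LetterOf N) u → lastExceeds u (just (suc N)) ≡ true → lastExceeds u (just c) ≡ true
lastExceeds-top (nothing ∷ [])    c _                 _   = refl
lastExceeds-top (just d ∷ [])     c (d∈N ∷ _)         top with trans (sym top) (exceeds-top (just d) d∈N)
... | ()
lastExceeds-top (x ∷ y ∷ u)       c (_ ∷ pu)          top = lastExceeds-top (y ∷ u) c pu top

lastExceeds-top≡endsInHole : ∀ {N} u → All (LetterOf N) u → lastExceeds u (just (suc N)) ≡ endsInHole u
lastExceeds-top≡endsInHole []          []            = refl
lastExceeds-top≡endsInHole (x ∷ [])    (px ∷ [])     = exceeds-top x px
lastExceeds-top≡endsInHole (x ∷ y ∷ u) (_ ∷ pu)      = lastExceeds-top≡endsInHole (y ∷ u) pu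

elemℕ-take : ∀ b p (w : Word) → elemℕ b (numerals w) ≡ false → elemℕ b (numerals (take p w)) ≡ false
elemℕ-take b zero    w              _   = refl
elemℕ-take b (suc p) []             _   = refl
elemℕ-take b (suc p) (nothing ∷ w)  b∉w = elemℕ-take b p w b∉w
elemℕ-take b (suc p) (just a ∷ w)   b∉w with b ≡ᵇ a
... | false = elemℕ-take b p w b∉w

take-∷ʳ : ∀ {p} (u : Word) y → p ≤ length u → take p (u ∷ʳ y) ≡ take p u
take-∷ʳ {zero}  u       y _         = refl
take-∷ʳ {suc p} (a ∷ u) y (s≤s p≤u) = cong (a ∷_) (take-∷ʳ u y p≤u)

all-range1 : ∀ {N d} (P : ℕ → Bool) → all P (range1 N) ≡ true → InRange N d → P d ≡ true
all-range1 {zero}  {zero}  P _    (() , _)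
all-range1 {suc N} {d}     P allP (1≤d , d≤N+1)
  with ∧-true (all P (range1 N)) (P (suc N)) (trans (sym (all-∷ʳ P (range1 N) (suc N))) (trans (cong (all P) (sym (range1-suc N))) allP))
... | allN , top with m≤n⇒m<n∨m≡n d≤N+1
...   | inj₁ (s≤s d≤N) = all-range1 P allN (1≤d , d≤N)
...   | inj₂ refl      = top

isRlmin-top-missing : ∀ {N d} T → InRange N d → elemℕ d T ≡ false → isRlmin T (suc N) ≡ false
isRlmin-top-missing {N} T d∈N d∉T with isRlmin T (suc N) in rl
... | false = refl
... | true  = trans (sym (all-range1 (λ b → elemℕ b T) rl d∈N)) d∉T

isPartialPerm-insertAt : ∀ {N} k p u → All (LetterOf N) u → isPartialPerm k (insertAt p (just (suc N)) u) ≡ isPartialPerm k u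
isPartialPerm-insertAt {N} k p u pu = cong₂ (λ h nd → (h ≡ᵇ k) ∧ nd) (countB-insertAt isHole p (just (suc N)) u)
  (trans (noDup-numerals-insertAt p (suc N) u) (cong (λ e → not e ∧ noDup (numerals u)) (elemℕ-top (numerals u) (numerals-InRange u pu))))

maj0-insertAt-before : ∀ z u′ y {p} → p < length u′ →
  maj0 (insertAt p z (u′ ∷ʳ y)) ≡ maj0 (insertAt p z u′) + onlyIf (lastExceeds u′ y) (suc (length u′))
maj0-insertAt-before z u′ y {p} p< = begin
  maj0 (insertAt p z (u′ ∷ʳ y))
    ≡⟨ cong maj0 (insertAt-∷ʳ z u′ y (<⇒≤ p<)) ⟩
  maj0 (insertAt p z u′ ∷ʳ y)
    ≡⟨ maj0-∷ʳ (insertAt p z u′) y ⟩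
  maj0 (insertAt p z u′) + onlyIf (lastExceeds (insertAt p z u′) y) (length (insertAt p z u′))
    ≡⟨ cong₂ (λ c l → maj0 (insertAt p z u′) + onlyIf c l) (lastExceeds-insertAt z u′ y p<) (length-insertAt p z u′) ⟩
  maj0 (insertAt p z u′) + onlyIf (lastExceeds u′ y) (suc (length u′)) ∎
  where open ≡-Reasoning

maj0-insertTop-beforeLast : ∀ {N} u′ y → LetterOf N y →
  maj0 (insertAt (length u′) (just (suc N)) (u′ ∷ʳ y)) ≡ maj0 (u′ ∷ʳ just (suc N)) + onlyIf (not (isHole y)) (suc (length u′))
maj0-insertTop-beforeLast {N} u′ y py = begin
  maj0 (insertAt (length u′) Z (u′ ∷ʳ y))
    ≡⟨ cong maj0 (trans (insertAt-∷ʳ Z u′ y ≤-refl) (cong (_∷ʳ y) (insertAt-length Z u′))) ⟩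
  maj0 (u′ ∷ʳ Z ∷ʳ y)
    ≡⟨ maj0-∷ʳ (u′ ∷ʳ Z) y ⟩
  maj0 (u′ ∷ʳ Z) + onlyIf (lastExceeds (u′ ∷ʳ Z) y) (length (u′ ∷ʳ Z))
    ≡⟨ cong₂ (λ c l → maj0 (u′ ∷ʳ Z) + onlyIf c l) (trans (lastExceeds-∷ʳ u′ Z y) (top-exceeds y py)) (length-∷ʳ u′ Z) ⟩
  maj0 (u′ ∷ʳ Z) + onlyIf (not (isHole y)) (suc (length u′)) ∎
  where open ≡-Reasoning
        Z = just (suc N)

maj0-insertTop-afterLast : ∀ {N} u′ y → LetterOf N y →
  maj0 (insertAt (suc (length u′)) (just (suc N)) (u′ ∷ʳ y)) ≡ maj0 (u′ ∷ʳ y) + onlyIf (isHole y) (suc (length u′))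
maj0-insertTop-afterLast {N} u′ y py = begin
  maj0 (insertAt (suc (length u′)) Z (u′ ∷ʳ y))
    ≡⟨ cong maj0 (trans (cong (λ p → insertAt p Z (u′ ∷ʳ y)) (sym (length-∷ʳ u′ y))) (insertAt-length Z (u′ ∷ʳ y))) ⟩
  maj0 (u′ ∷ʳ y ∷ʳ Z)
    ≡⟨ maj0-∷ʳ (u′ ∷ʳ y) Z ⟩
  maj0 (u′ ∷ʳ y) + onlyIf (lastExceeds (u′ ∷ʳ y) Z) (length (u′ ∷ʳ y))
    ≡⟨ cong₂ (λ c l → maj0 (u′ ∷ʳ y) + onlyIf c l) (trans (lastExceeds-∷ʳ u′ y Z) (exceeds-top y py)) (length-∷ʳ u′ y) ⟩
  maj0 (u′ ∷ʳ y) + onlyIf (isHole y) (suc (length u′)) ∎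
  where open ≡-Reasoning
        Z = just (suc N)

maj0-∷ʳ-noDescent : ∀ u′ x → lastExceeds u′ x ≡ false → maj0 (u′ ∷ʳ x) ≡ maj0 u′
maj0-∷ʳ-noDescent u′ x noDescent = trans (maj0-∷ʳ u′ x) (trans (cong (λ e → maj0 u′ + onlyIf e (length u′)) noDescent) (+-identityʳ _))

-- The maj generating function
module MajGF (β q : ℕ) where
  open QNumbers β q

  carlitz-noShift : ∀ X G t m → X + G ≡ t * qnum (suc m) → X + G + t * q ^ suc m ≡ t * qnum (suc (suc m))
  carlitz-noShift X G t m IH = begin
    X + G + t * q ^ suc m             ≡⟨ cong (_+ t * q ^ suc m) IH ⟩
    t * qnum (suc m) + t * q ^ suc m  ≡⟨ sym (*-distribˡ-+ t _ _) ⟩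
    t * (qnum (suc m) + q ^ suc m)    ≡⟨ cong (t *_) (sym (qnum-suc (suc m))) ⟩
    t * qnum (suc (suc m))            ∎
    where open ≡-Reasoning

  carlitz-shift : ∀ X G t m → X + G ≡ t * qnum (suc m) → q ^ suc m * X + G * q ^ suc m + t * q ^ m ≡ t * q ^ m * qnum (suc (suc m))
  carlitz-shift X G t m IH = begin
    q ^ suc m * X + G * q ^ suc m + t * q ^ m   ≡⟨ factor (q ^ suc m) X G (t * q ^ m) ⟩
    q ^ suc m * (X + G) + t * q ^ m             ≡⟨ cong (λ x → q ^ suc m * x + t * q ^ m) IH ⟩
    q * q ^ m * (t * qnum (suc m)) + t * q ^ m  ≡⟨ collect q (q ^ m) t (qnum (suc m)) ⟩
    t * q ^ m * qnum (suc (suc m))              ∎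
    where open ≡-Reasoning
          factor : ∀ s x g r → s * x + g * s + r ≡ s * (x + g) + r
          factor = solve-∀
          collect : ∀ q s t w → q * s * (t * w) + t * s ≡ t * s * (1 + q * w)
          collect = solve-∀

  -- X is the contribution of the slots inside u′; how the last letter y shifts them and the two
  -- slots around y depends only on whether y is a hole and whether u′ ends with a descent onto y.
  carlitz-step : ∀ {N} u′ y → All (LetterOf N) u′ → LetterOf N y → ∀ X → let m = length u′ ; Z = just (suc N) in
    X + q ^ maj0 (u′ ∷ʳ Z) ≡ q ^ maj0 u′ * qnum (suc m) →
    q ^ onlyIf (lastExceeds u′ y) (suc m) * X + q ^ (maj0 (u′ ∷ʳ Z) + onlyIf (not (isHole y)) (suc m))
      + q ^ (maj0 (u′ ∷ʳ y) + onlyIf (isHole y) (suc m)) ≡ q ^ maj0 (u′ ∷ʳ y) * qnum (suc (suc m))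
  carlitz-step {N} u′ nothing pu′ _ X IH rewrite lastExceeds-hole u′ | maj0-∷ʳ-noDescent u′ nothing (lastExceeds-hole u′) = begin
    1 * X + q ^ (maj0 (u′ ∷ʳ Z) + 0) + q ^ (A + suc m)
      ≡⟨ cong₃ (λ x y z → x + q ^ y + z) (*-identityˡ X) (+-identityʳ (maj0 (u′ ∷ʳ Z))) (q^-+ A (suc m)) ⟩
    X + q ^ maj0 (u′ ∷ʳ Z) + q ^ A * q ^ suc m
      ≡⟨ carlitz-noShift X (q ^ maj0 (u′ ∷ʳ Z)) (q ^ A) m IH ⟩
    q ^ A * qnum (suc (suc m)) ∎
    where open ≡-Reasoning
          Z = just (suc N)
          A = maj0 u′
          m = length u′
  carlitz-step {N} u′ (just d) pu′ _ X IH with lastExceeds u′ (just d) in descent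
  ... | true = begin
    q ^ suc m * X + q ^ (maj0 (u′ ∷ʳ Z) + suc m) + q ^ (maj0 (u′ ∷ʳ just d) + 0)
      ≡⟨ cong₂ (λ y z → q ^ suc m * X + y + z) (q^-+ (maj0 (u′ ∷ʳ Z)) (suc m)) (trans (cong (q ^_) (trans (+-identityʳ _) M≡A+m)) (q^-+ A m)) ⟩
    q ^ suc m * X + q ^ maj0 (u′ ∷ʳ Z) * q ^ suc m + q ^ A * q ^ m
      ≡⟨ carlitz-shift X (q ^ maj0 (u′ ∷ʳ Z)) (q ^ A) m IH ⟩
    q ^ A * q ^ m * qnum (suc (suc m))
      ≡⟨ cong (_* qnum (suc (suc m))) (trans (sym (q^-+ A m)) (cong (q ^_) (sym M≡A+m))) ⟩
    q ^ maj0 (u′ ∷ʳ just d) * qnum (suc (suc m)) ∎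
    where open ≡-Reasoning
          Z = just (suc N)
          A = maj0 u′
          m = length u′
          M≡A+m : maj0 (u′ ∷ʳ just d) ≡ A + m
          M≡A+m = trans (maj0-∷ʳ u′ (just d)) (cong (λ e → A + onlyIf e m) descent)
  ... | false = begin
    1 * X + q ^ (maj0 (u′ ∷ʳ Z) + suc m) + q ^ (maj0 (u′ ∷ʳ just d) + 0)
      ≡⟨ cong₃ (λ x y z → x + q ^ y + q ^ z) (*-identityˡ X) (cong (_+ suc m) A≡) (trans (+-identityʳ _) (maj0-∷ʳ-noDescent u′ (just d) descent)) ⟩
    X + q ^ (A + suc m) + q ^ A
      ≡⟨ cong (λ x → X + x + q ^ A) (q^-+ A (suc m)) ⟩
    X + q ^ A * q ^ suc m + q ^ A
      ≡⟨ +-CS.xy∙z≈xz∙y X (q ^ A * q ^ suc m) (q ^ A) ⟩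
    X + q ^ A + q ^ A * q ^ suc m
      ≡⟨ carlitz-noShift X (q ^ A) (q ^ A) m (subst (λ e → X + q ^ e ≡ q ^ A * qnum (suc m)) A≡ IH) ⟩
    q ^ A * qnum (suc (suc m))
      ≡⟨ cong (λ e → q ^ e * qnum (suc (suc m))) (sym (maj0-∷ʳ-noDescent u′ (just d) descent)) ⟩
    q ^ maj0 (u′ ∷ʳ just d) * qnum (suc (suc m)) ∎
    where
    open ≡-Reasoning
    Z = just (suc N)
    A = maj0 u′
    m = length u′
    noTopDescent : lastExceeds u′ Z ≡ false
    noTopDescent with lastExceeds u′ Z in top
    ... | false = refl
    ... | true  = trans (sym (lastExceeds-top u′ d pu′ top)) descent
    A≡ : maj0 (u′ ∷ʳ Z) ≡ A
    A≡ = maj0-∷ʳ-noDescent u′ Z noTopDescent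

  -- Carlitz: the slots for a new largest numeral raise maj₀ by 0, 1, …, length u in some order.
  ∑-maj0-insertAt : ∀ {N} u → All (LetterOf N) u →
    ∑[ p ∈ upTo (suc (length u)) ] (q ^ maj0 (insertAt p (just (suc N)) u)) ≡ q ^ maj0 u * qnum (suc (length u))
  ∑-maj0-insertAt {N} u = go u (reverseView u)
    where
    Z = just (suc N)
    go : ∀ u → Reverse u → All (LetterOf N) u →
         ∑[ p ∈ upTo (suc (length u)) ] (q ^ maj0 (insertAt p Z u)) ≡ q ^ maj0 u * qnum (suc (length u))
    go .[]       []               _  = sym (trans (*-identityˡ (qnum 1)) (cong suc (*-zeroʳ q)))
    go .(u′ ∷ʳ y) (u′ ∶ rev ∶ʳ y) pu rewrite length-∷ʳ u′ y = begin
      ∑ (upTo (suc (suc m))) F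
        ≡⟨ trans (∑-upTo-sucʳ (suc m) F) (cong (_+ F (suc m)) (∑-upTo-sucʳ m F)) ⟩
      ∑ (upTo m) F + F m + F (suc m)
        ≡⟨ cong₃ (λ x y z → x + y + z)
                 (trans (∑-cong-All (All.all-upTo m) shift) (∑-*ˡ (upTo m) (q ^ onlyIf (lastExceeds u′ y) (suc m)) G))
                 (cong (q ^_) (maj0-insertTop-beforeLast u′ y py))
                 (cong (q ^_) (maj0-insertTop-afterLast u′ y py)) ⟩
      q ^ onlyIf (lastExceeds u′ y) (suc m) * X + q ^ (maj0 (u′ ∷ʳ Z) + onlyIf (not (isHole y)) (suc m))
        + q ^ (maj0 (u′ ∷ʳ y) + onlyIf (isHole y) (suc m))
        ≡⟨ carlitz-step u′ y pu′ py X IH ⟩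
      q ^ maj0 (u′ ∷ʳ y) * qnum (suc (suc m)) ∎
      where
      open ≡-Reasoning
      pu′ = proj₁ (All.∷ʳ⁻ pu)
      py = proj₂ (All.∷ʳ⁻ pu)
      m = length u′
      F = λ p → q ^ maj0 (insertAt p Z (u′ ∷ʳ y))
      G = λ p → q ^ maj0 (insertAt p Z u′)
      X = ∑ (upTo m) G
      shift : ∀ p → p < m → F p ≡ q ^ onlyIf (lastExceeds u′ y) (suc m) * G p
      shift p p<m = trans (cong (q ^_) (maj0-insertAt-before Z u′ y p<m)) (trans (q^-+ (maj0 (insertAt p Z u′)) _) (*-comm (G p) _))
      IH : X + q ^ maj0 (u′ ∷ʳ Z) ≡ q ^ maj0 u′ * qnum (suc m)
      IH = trans (cong (λ w → X + q ^ maj0 w) (sym (insertAt-length Z u′))) (trans (sym (∑-upTo-sucʳ m G)) (go u′ rev pu′))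

  -- The factor by which inserting N+1 at slot p changes β ^ rlmin · q ^ maj₀; results
  -- ending in a hole are left to Hmaj.
  insertWeight : ℕ → Word → ℕ → ℕ
  insertWeight N u p = if endsInHole (insertAt p (just (suc N)) u) then 0
                       else βif (isRlmin (numerals (take p u)) (suc N)) * q ^ maj0 (insertAt p (just (suc N)) u)

  slotFactor : ℕ → Word → ℕ
  slotFactor c u = if endsInHole u then βif (c ≡ᵇ 0) * q ^ length u else βif (c ≡ᵇ 0) + q * qnum (length u)

  insertWeight-end : ∀ {N} u → All (LetterOf N) u →
    insertWeight N u (length u) ≡ βif (missing N (numerals u) ≡ᵇ 0) * q ^ (maj0 u + onlyIf (endsInHole u) (length u))
  insertWeight-end {N} u pu rewrite insertAt-length (just (suc N)) u | endsInHole-∷ʳ u (just (suc N)) = cong₂ (λ r m → βif r * q ^ m)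
    (trans (cong (λ w → isRlmin (numerals w) (suc N)) (take-all (length u) u ≤-refl)) (isRlmin-suc N (numerals u)))
    (trans (maj0-∷ʳ u (just (suc N))) (cong (λ e → maj0 u + onlyIf e (length u)) (lastExceeds-top≡endsInHole u pu)))

  insertWeight-before : ∀ {N} u → All (LetterOf N) u → noDup (numerals u) ≡ true → ∀ p → p < length u →
    insertWeight N u p ≡ (if endsInHole u then 0 else q ^ maj0 (insertAt p (just (suc N)) u))
  insertWeight-before {N} u = go u (reverseView u)
    where
    Z = just (suc N)
    go : ∀ u → Reverse u → All (LetterOf N) u → noDup (numerals u) ≡ true → ∀ p → p < length u →
         insertWeight N u p ≡ (if endsInHole u then 0 else q ^ maj0 (insertAt p Z u))
    go .(u′ ∷ʳ y) (u′ ∶ _ ∶ʳ y) pu nd p p<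
      rewrite insertAt-∷ʳ Z u′ y (≤-pred (subst (p <_) (length-∷ʳ u′ y) p<))
            | endsInHole-∷ʳ (insertAt p Z u′) y | endsInHole-∷ʳ u′ y = lastNumeral y (proj₂ (All.∷ʳ⁻ pu)) nd
      where
      p≤u′ = ≤-pred (subst (p <_) (length-∷ʳ u′ y) p<)
      lastNumeral : ∀ y → LetterOf N y → noDup (numerals (u′ ∷ʳ y)) ≡ true →
        (if isHole y then 0 else βif (isRlmin (numerals (take p (u′ ∷ʳ y))) (suc N)) * q ^ maj0 (insertAt p Z u′ ∷ʳ y))
          ≡ (if isHole y then 0 else q ^ maj0 (insertAt p Z u′ ∷ʳ y))
      lastNumeral nothing  _   _  = refl
      lastNumeral (just d) d∈N nd rewrite take-∷ʳ u′ (just d) p≤u′ =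
        cong (λ r → βif r * q ^ maj0 (insertAt p Z u′ ∷ʳ just d))
             (isRlmin-top-missing (numerals (take p u′)) d∈N (elemℕ-take d p u′ d∉u′))
        ⟨ trans ⟩ *-identityˡ _
        where
        d∉u′ : elemℕ d (numerals u′) ≡ false
        d∉u′ with elemℕ d (numerals u′) | ∧-true (noDup (numerals u′)) _ (trans (sym (trans (cong noDup (numerals-∷ʳ u′ d)) (noDup-∷ʳ (numerals u′) d))) nd)
        ... | false | _      = refl
        ... | true  | _ , ()

  ∑-maj0-insertAt-init : ∀ {N} u → All (LetterOf N) u → endsInHole u ≡ false →
    ∑[ p ∈ upTo (length u) ] (q ^ maj0 (insertAt p (just (suc N)) u)) ≡ q ^ maj0 u * (q * qnum (length u))
  ∑-maj0-insertAt-init {N} u pu noHole = +-cancelʳ-≡ (q ^ M) _ _ (begin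
    X + q ^ M                         ≡⟨ cong (λ m → X + q ^ m) (sym lastSlot) ⟩
    X + G L                           ≡⟨ sym (∑-upTo-sucʳ L G) ⟩
    ∑ (upTo (suc L)) G                ≡⟨ ∑-maj0-insertAt u pu ⟩
    q ^ M * (1 + q * qnum L)          ≡⟨ expand (q ^ M) q (qnum L) ⟩
    q ^ M * (q * qnum L) + q ^ M      ∎)
    where
    open ≡-Reasoning
    Z = just (suc N)
    L = length u
    M = maj0 u
    G = λ p → q ^ maj0 (insertAt p Z u)
    X = ∑ (upTo L) G
    expand : ∀ t q y → t * (1 + q * y) ≡ t * (q * y) + t
    expand = solve-∀
    lastSlot : maj0 (insertAt L Z u) ≡ M
    lastSlot = begin
      maj0 (insertAt L Z u)           ≡⟨ cong maj0 (insertAt-length Z u) ⟩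
      maj0 (u ∷ʳ Z)                   ≡⟨ maj0-∷ʳ u Z ⟩
      M + onlyIf (lastExceeds u Z) L  ≡⟨ cong (λ e → M + onlyIf e L) (trans (lastExceeds-top≡endsInHole u pu) noHole) ⟩
      M + 0                           ≡⟨ +-identityʳ M ⟩
      M                               ∎

  ∑-insertWeight : ∀ {N} u → All (LetterOf N) u → noDup (numerals u) ≡ true →
    ∑ (upTo (suc (length u))) (insertWeight N u) ≡ q ^ maj0 u * slotFactor (missing N (numerals u)) u
  ∑-insertWeight {N} u pu nd = begin
    ∑ (upTo (suc L)) (insertWeight N u)
      ≡⟨ ∑-upTo-sucʳ L (insertWeight N u) ⟩
    ∑ (upTo L) (insertWeight N u) + insertWeight N u L
      ≡⟨ cong₂ _+_ (∑-cong-All (All.all-upTo L) (insertWeight-before u pu nd)) (insertWeight-end u pu) ⟩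
    ∑[ p ∈ upTo L ] (if endsInHole u then 0 else G p) + a * q ^ (M + onlyIf (endsInHole u) L)
      ≡⟨ byEnding (endsInHole u) refl ⟩
    q ^ M * slotFactor c u ∎
    where
    open ≡-Reasoning
    L = length u
    M = maj0 u
    c = missing N (numerals u)
    a = βif (c ≡ᵇ 0)
    G = λ p → q ^ maj0 (insertAt p (just (suc N)) u)
    byEnding : ∀ e → endsInHole u ≡ e → ∑[ p ∈ upTo L ] (if e then 0 else G p) + a * q ^ (M + onlyIf e L)
                                         ≡ q ^ M * (if e then a * q ^ L else a + q * qnum L)
    byEnding true  _       = begin
      ∑[ p ∈ upTo L ] 0 + a * q ^ (M + L)    ≡⟨ cong₂ (λ x y → x + a * y) (∑-zero (upTo L)) (q^-+ M L) ⟩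
      a * (q ^ M * q ^ L)                    ≡⟨ *-CS.x∙yz≈y∙xz a (q ^ M) (q ^ L) ⟩
      q ^ M * (a * q ^ L)                    ∎
    byEnding false noHole = begin
      ∑ (upTo L) G + a * q ^ (M + 0)         ≡⟨ cong₂ (λ x y → x + a * q ^ y) (∑-maj0-insertAt-init u pu noHole) (+-identityʳ M) ⟩
      q ^ M * (q * qnum L) + a * q ^ M       ≡⟨ collect (q ^ M) q (qnum L) a ⟩
      q ^ M * (a + q * qnum L)               ∎
      where collect : ∀ t q y a → t * (q * y) + a * t ≡ t * (a + q * y)
            collect = solve-∀

  weightMaj : ℕ → Word → ℕ
  weightMaj N w = β ^ rlmin w * q ^ maj N w

  termMaj termMajNum termMajHole : ℕ → ℕ → Word → ℕ
  termMaj     N k w = if isPartialPerm k w then weightMaj N w else 0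
  termMajNum  N k w = if isPartialPerm k w then (if endsInHole w then 0 else weightMaj N w) else 0
  termMajHole N k w = if isPartialPerm k w then (if endsInHole w then weightMaj N w else 0) else 0

  Fmaj Emaj Hmaj : ℕ → ℕ → ℕ → ℕ
  Fmaj N L k = ∑ (allWords N L) (termMaj N k)
  Emaj N L k = ∑ (allWords N L) (termMajNum N k)
  Hmaj N L k = ∑ (allWords N L) (termMajHole N k)

  Fmaj≡Emaj+Hmaj : ∀ N L k → Fmaj N L k ≡ Emaj N L k + Hmaj N L k
  Fmaj≡Emaj+Hmaj N L k = trans (∑-cong (allWords N L) split) (∑-+ (allWords N L) (termMajNum N k) (termMajHole N k))
    where split : ∀ w → termMaj N k w ≡ termMajNum N k w + termMajHole N k w
          split w with isPartialPerm k w | endsInHole w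
          ... | false | _     = refl
          ... | true  | true  = refl
          ... | true  | false = sym (+-identityʳ _)

  weightMaj-∷ʳ-hole : ∀ N w → weightMaj N (w ∷ʳ nothing) ≡ weightMaj N w
  weightMaj-∷ʳ-hole N w = cong₂ (λ r m → β ^ r * q ^ m) (trans (rlmin-∷ʳ [] w nothing) (+-identityʳ _))
    (cong₂ _+_ (trans (maj0-∷ʳ w nothing) (trans (cong (λ e → maj0 w + onlyIf e (length w)) (lastExceeds-hole w)) (+-identityʳ _)))
               (cong (λ T → ∑ T (missingBelow N T)) (numerals-∷ʳ-hole w)))

  Hmaj-suc : ∀ N L k → Hmaj N (suc L) k ≡ ∑[ w ∈ allWords N L ] (if (suc (holes w) ≡ᵇ k) ∧ noDup (numerals w) then weightMaj N w else 0)
  Hmaj-suc N L k = trans (∑-allWords-∷ʳ N L (termMajHole N k)) (∑-cong (allWords N L) (λ w → begin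
    ∑[ x ∈ letters N ] termMajHole N k (w ∷ʳ x)
      ≡⟨ ∑-letters N (λ x → termMajHole N k (w ∷ʳ x)) ⟩
    termMajHole N k (w ∷ʳ nothing) + ∑[ a ∈ range1 N ] termMajHole N k (w ∷ʳ just a)
      ≡⟨ cong₂ _+_ (cong₃ (λ v e x → if v then (if e then x else 0) else 0) (isPartialPerm-∷ʳ-hole k w) (endsInHole-∷ʳ w nothing) (weightMaj-∷ʳ-hole N w))
                   (trans (∑-cong (range1 N) (λ a → cong (λ e → if isPartialPerm k (w ∷ʳ just a) then (if e then weightMaj N (w ∷ʳ just a) else 0) else 0) (endsInHole-∷ʳ w (just a))
                                                    ⟨ trans ⟩ if-eta (isPartialPerm k (w ∷ʳ just a))))
                          (∑-zero (range1 N))) ⟩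
    (if (suc (holes w) ≡ᵇ k) ∧ noDup (numerals w) then weightMaj N w else 0) + 0
      ≡⟨ +-identityʳ _ ⟩
    (if (suc (holes w) ≡ᵇ k) ∧ noDup (numerals w) then weightMaj N w else 0) ∎))
    where open ≡-Reasoning

  Emaj-emptyAlphabet : ∀ L k → Emaj 0 (suc L) k ≡ 0
  Emaj-emptyAlphabet L k = trans (∑-allWords-∷ʳ 0 L (termMajNum 0 k)) (trans (∑-cong (allWords 0 L) (λ w →
    trans (+-identityʳ _) (trans (cong (λ e → if isPartialPerm k (w ∷ʳ nothing) then (if e then 0 else weightMaj 0 (w ∷ʳ nothing)) else 0) (endsInHole-∷ʳ w nothing))
                                 (if-eta (isPartialPerm k (w ∷ʳ nothing)))))) (∑-zero (allWords 0 L)))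

  weightMaj-insertAt : ∀ {N} p u → All (LetterOf N) u →
    weightMaj (suc N) (insertAt p (just (suc N)) u)
      ≡ β ^ rlmin u * q ^ (invSets N u + missing N (numerals u)) * (βif (isRlmin (numerals (take p u)) (suc N)) * q ^ maj0 (insertAt p (just (suc N)) u))
  weightMaj-insertAt {N} p u pu = begin
    β ^ rlmin w * q ^ (maj0 w + invSets (suc N) w)
      ≡⟨ cong₂ (λ r i → β ^ r * q ^ (maj0 w + i)) (rlmin-insertAt [] p u pu) (invSets-insertAt p u pu) ⟩
    β ^ (rlmin u + ind r) * q ^ (maj0 w + (invSets N u + c))
      ≡⟨ cong₂ _*_ (^-distribˡ-+-* β (rlmin u) (ind r)) (q^-+ (maj0 w) (invSets N u + c)) ⟩
    β ^ rlmin u * β ^ ind r * (q ^ maj0 w * q ^ (invSets N u + c))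
      ≡⟨ cong (λ x → β ^ rlmin u * x * (q ^ maj0 w * q ^ (invSets N u + c))) (β^ind≡βif r) ⟩
    β ^ rlmin u * βif r * (q ^ maj0 w * q ^ (invSets N u + c))
      ≡⟨ regroup (β ^ rlmin u) (βif r) (q ^ maj0 w) (q ^ (invSets N u + c)) ⟩
    β ^ rlmin u * q ^ (invSets N u + c) * (βif r * q ^ maj0 w) ∎
    where
    open ≡-Reasoning
    w = insertAt p (just (suc N)) u
    r = isRlmin (numerals (take p u)) (suc N)
    c = missing N (numerals u)
    regroup : ∀ a b c d → a * b * (c * d) ≡ a * d * (b * c)
    regroup = solve-∀

  ∑-termMajNum-insertAt : ∀ {N} k u → All (LetterOf N) u →
    ∑[ p ∈ upTo (suc (length u)) ] termMajNum (suc N) k (insertAt p (just (suc N)) u)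
      ≡ (if isPartialPerm k u then weightMaj N u * (q ^ missing N (numerals u) * slotFactor (missing N (numerals u)) u) else 0)
  ∑-termMajNum-insertAt {N} k u pu = trans (∑-cong (upTo (suc (length u))) term) (sumUp (isPartialPerm k u) refl)
    where
    Z = just (suc N)
    c = missing N (numerals u)
    K = β ^ rlmin u * q ^ (invSets N u + c)
    term : ∀ p → termMajNum (suc N) k (insertAt p Z u) ≡ (if isPartialPerm k u then K * insertWeight N u p else 0)
    term p rewrite isPartialPerm-insertAt k p u pu with isPartialPerm k u | endsInHole (insertAt p Z u)
    ... | false | _     = refl
    ... | true  | true  = sym (*-zeroʳ K)
    ... | true  | false = weightMaj-insertAt p u pu
    sumUp : ∀ v → isPartialPerm k u ≡ v → ∑[ p ∈ upTo (suc (length u)) ] (if v then K * insertWeight N u p else 0)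
                                           ≡ (if v then weightMaj N u * (q ^ c * slotFactor c u) else 0)
    sumUp false _  = ∑-zero (upTo (suc (length u)))
    sumUp true  pp = begin
      ∑[ p ∈ upTo (suc (length u)) ] (K * insertWeight N u p)
        ≡⟨ ∑-*ˡ (upTo (suc (length u))) K (insertWeight N u) ⟩
      K * ∑ (upTo (suc (length u))) (insertWeight N u)
        ≡⟨ cong (K *_) (∑-insertWeight u pu (isPartialPerm⇒noDup k u pp)) ⟩
      β ^ rlmin u * q ^ (invSets N u + c) * (q ^ maj0 u * slotFactor c u)
        ≡⟨ cong (λ x → β ^ rlmin u * x * (q ^ maj0 u * slotFactor c u)) (q^-+ (invSets N u) c) ⟩
      β ^ rlmin u * (q ^ invSets N u * q ^ c) * (q ^ maj0 u * slotFactor c u)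
        ≡⟨ regroup (β ^ rlmin u) (q ^ invSets N u) (q ^ c) (q ^ maj0 u) (slotFactor c u) ⟩
      β ^ rlmin u * (q ^ maj0 u * q ^ invSets N u) * (q ^ c * slotFactor c u)
        ≡⟨ cong (λ x → β ^ rlmin u * x * (q ^ c * slotFactor c u)) (sym (q^-+ (maj0 u) (invSets N u))) ⟩
      weightMaj N u * (q ^ c * slotFactor c u) ∎
      where open ≡-Reasoning
            regroup : ∀ b i c m r → b * (i * c) * (m * r) ≡ b * (m * i) * (c * r)
            regroup = solve-∀

  if-slotFactor : ∀ v e W C a L → (if v then W * (C * (if e then a * q ^ L else a + q * qnum L)) else 0)
    ≡ C * ((a + q * qnum L) * (if v then (if e then 0 else W) else 0) + a * q ^ L * (if v then (if e then W else 0) else 0))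
  if-slotFactor false e     W C a L = sym (vanish C (a + q * qnum L) (a * q ^ L))
    where vanish : ∀ c y x → c * (y * 0 + x * 0) ≡ 0
          vanish = solve-∀
  if-slotFactor true  true  W C a L = regroup W C (a + q * qnum L) (a * q ^ L)
    where regroup : ∀ w c y x → w * (c * x) ≡ c * (y * 0 + x * w)
          regroup = solve-∀
  if-slotFactor true  false W C a L = regroup W C (a + q * qnum L) (a * q ^ L)
    where regroup : ∀ w c y x → w * (c * y) ≡ c * (y * w + x * 0)
          regroup = solve-∀

  ∑-termMajNum-insertTop : ∀ {N L} k u → WordOver N L u → let c = N ∸ (L ∸ k) ; a = βif (c ≡ᵇ 0) in
    ∑[ p ∈ upTo (suc L) ] termMajNum (suc N) k (insertAt p (just (suc N)) u)
      ≡ q ^ c * ((a + q * qnum L) * termMajNum N k u + a * q ^ L * termMajHole N k u)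
  ∑-termMajNum-insertTop {N} k u (refl , pu) = begin
    ∑[ p ∈ upTo (suc (length u)) ] termMajNum (suc N) k (insertAt p (just (suc N)) u)
      ≡⟨ ∑-termMajNum-insertAt k u pu ⟩
    (if isPartialPerm k u then weightMaj N u * (q ^ missing N (numerals u) * slotFactor (missing N (numerals u)) u) else 0)
      ≡⟨ fixMissing (isPartialPerm k u) refl ⟩
    (if isPartialPerm k u then weightMaj N u * (q ^ c * slotFactor c u) else 0)
      ≡⟨ if-slotFactor (isPartialPerm k u) (endsInHole u) (weightMaj N u) (q ^ c) (βif (c ≡ᵇ 0)) (length u) ⟩
    q ^ c * ((βif (c ≡ᵇ 0) + q * qnum (length u)) * termMajNum N k u + βif (c ≡ᵇ 0) * q ^ length u * termMajHole N k u) ∎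
    where
    open ≡-Reasoning
    c = N ∸ (length u ∸ k)
    fixMissing : ∀ v → isPartialPerm k u ≡ v →
      (if v then weightMaj N u * (q ^ missing N (numerals u) * slotFactor (missing N (numerals u)) u) else 0)
        ≡ (if v then weightMaj N u * (q ^ c * slotFactor c u) else 0)
    fixMissing false _  = refl
    fixMissing true  pp = cong (λ m → weightMaj N u * (q ^ m * slotFactor m u)) (isPartialPerm⇒missing u (refl , pu) pp)

  Emaj-suc : ∀ N L k → let c = N ∸ (L ∸ k) ; a = βif (c ≡ᵇ 0) in
    Emaj (suc N) (suc L) k ≡ Emaj N (suc L) k + q ^ c * ((a + q * qnum L) * Emaj N L k + a * q ^ L * Hmaj N L k)
  Emaj-suc N L k = begin
    Emaj (suc N) (suc L) k
      ≡⟨ ∑-allWords-insertTop N L (termMajNum (suc N) k) repeated ⟩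
    ∑ (allWords N (suc L)) (termMajNum (suc N) k) + ∑[ u ∈ allWords N L ] ∑[ p ∈ upTo (suc L) ] termMajNum (suc N) k (insertAt p Z u)
      ≡⟨ cong₂ _+_ (∑-cong-All (allWords-WordOver N (suc L)) (λ w (_ , pw) → lift w pw))
                   (∑-cong-All (allWords-WordOver N L) (∑-termMajNum-insertTop k)) ⟩
    Emaj N (suc L) k + ∑[ u ∈ allWords N L ] (q ^ c * (Y * termMajNum N k u + X * termMajHole N k u))
      ≡⟨ cong (Emaj N (suc L) k +_) (trans (∑-*ˡ (allWords N L) (q ^ c) _) (cong (q ^ c *_)
           (trans (∑-+ (allWords N L) _ _) (cong₂ _+_ (∑-*ˡ (allWords N L) Y (termMajNum N k)) (∑-*ˡ (allWords N L) X (termMajHole N k)))))) ⟩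
    Emaj N (suc L) k + q ^ c * (Y * Emaj N L k + X * Hmaj N L k) ∎
    where
    open ≡-Reasoning
    Z = just (suc N)
    c = N ∸ (L ∸ k)
    a = βif (c ≡ᵇ 0)
    Y = a + q * qnum L
    X = a * q ^ L
    repeated : ∀ w → 2 ≤ occurrences (suc N) w → termMajNum (suc N) k w ≡ 0
    repeated w occ = cong (λ b → if b then (if endsInHole w then 0 else weightMaj (suc N) w) else 0)
                          (trans (cong ((holes w ≡ᵇ k) ∧_) (occursTwice⇒¬noDup (suc N) w occ)) (∧-zeroʳ _))
    lift : ∀ w → All (LetterOf N) w → termMajNum (suc N) k w ≡ termMajNum N k w
    lift w pw = cong (λ i → if isPartialPerm k w then (if endsInHole w then 0 else β ^ rlmin w * q ^ (maj0 w + i)) else 0) (invSets-lift w pw)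

  Fmaj-closed-from : ∀ N L k → Emaj N L k ≡ qbinEndNum L k * βqfall N (L ∸ k) → Hmaj N L k ≡ qbinEndHole L k * βqfall N (L ∸ k) →
                     Fmaj N L k ≡ qbin L k * βqfall N (L ∸ k)
  Fmaj-closed-from N L k E≡ H≡ = begin
    Fmaj N L k                                               ≡⟨ Fmaj≡Emaj+Hmaj N L k ⟩
    Emaj N L k + Hmaj N L k                                  ≡⟨ cong₂ _+_ E≡ H≡ ⟩
    qbinEndNum L k * P + qbinEndHole L k * P                 ≡⟨ sym (*-distribʳ-+ P (qbinEndNum L k) (qbinEndHole L k)) ⟩
    (qbinEndNum L k + qbinEndHole L k) * P                   ≡⟨ cong (_* P) (sym (qbin-endNum+endHole L k)) ⟩
    qbin L k * P                                             ∎
    where open ≡-Reasoning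
          P = βqfall N (L ∸ k)

  Hmaj-closed : ∀ N → (∀ L k → Emaj N L k ≡ qbinEndNum L k * βqfall N (L ∸ k)) →
                ∀ L k → Hmaj N L k ≡ qbinEndHole L k * βqfall N (L ∸ k)
  Hmaj-closed N Emaj-closed zero    zero    = refl
  Hmaj-closed N Emaj-closed zero    (suc k) = refl
  Hmaj-closed N Emaj-closed (suc L) zero    = trans (Hmaj-suc N L 0) (∑-zero (allWords N L))
  Hmaj-closed N Emaj-closed (suc L) (suc k) =
    trans (Hmaj-suc N L (suc k)) (Fmaj-closed-from N L k (Emaj-closed L k) (Hmaj-closed N Emaj-closed L k))

  Emaj-closed : ∀ N L k → Emaj N L k ≡ qbinEndNum L k * βqfall N (L ∸ k)
  Emaj-closed N       zero    zero    = refl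
  Emaj-closed N       zero    (suc k) = refl
  Emaj-closed zero    (suc L) k       = begin
    Emaj 0 (suc L) k                                 ≡⟨ Emaj-emptyAlphabet L k ⟩
    0                                                ≡⟨ sym (*-zeroʳ (q ^ k)) ⟩
    q ^ k * 0                                        ≡⟨ cong (q ^ k *_) (sym (qbin-βqfall-emptyAlphabet L k)) ⟩
    q ^ k * (qbin L k * βqfall 0 (suc L ∸ k))        ≡⟨ sym (*-assoc (q ^ k) (qbin L k) (βqfall 0 (suc L ∸ k))) ⟩
    qbinEndNum (suc L) k * βqfall 0 (suc L ∸ k)      ∎
    where open ≡-Reasoning
  Emaj-closed (suc N) (suc L) k = begin
    Emaj (suc N) (suc L) k
      ≡⟨ Emaj-suc N L k ⟩
    Emaj N (suc L) k + q ^ c * ((a + q * qnum L) * Emaj N L k + a * q ^ L * Hmaj N L k)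
      ≡⟨ cong₃ (λ x y z → x + q ^ c * ((a + q * qnum L) * y + a * q ^ L * z))
               (Emaj-closed N (suc L) k) (Emaj-closed N L k) (Hmaj-closed N (Emaj-closed N) L k) ⟩
    qbinEndNum (suc L) k * βqfall N (suc L ∸ k)
      + q ^ c * ((a + q * qnum L) * (qbinEndNum L k * βqfall N (L ∸ k)) + a * q ^ L * (qbinEndHole L k * βqfall N (L ∸ k)))
      ≡⟨ sym (qbinEnd-insertion-step N L k) ⟩
    qbinEndNum (suc L) k * βqfall (suc N) (suc L ∸ k) ∎
    where open ≡-Reasoning
          c = N ∸ (L ∸ k)
          a = βif (c ≡ᵇ 0)

  sumRlminMaj≡qbin*βqfall : ∀ n k → sumRlminMaj n k β q ≡ qbin n k * βqfall n (n ∸ k)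
  sumRlminMaj≡qbin*βqfall n k = trans (∑-filter (isPartialPerm k) (allWords n n) (weightMaj n))
    (Fmaj-closed-from n n k (Emaj-closed n n k) (Hmaj-closed n (Emaj-closed n) n k))

theorem2p1 : (n k : ℕ) → k ≤ n → (β q : ℕ) →
    (sumRlminMaj n k β q ≡ sumRlminInv n k β q)
    × (sumRlminInv n k β q ≡ qbinom n k q * βqprod n k β q)
theorem2p1 n k k≤n β q =
  trans (MajGF.sumRlminMaj≡qbin*βqfall β q n k) (sym (InvGF.sumRlminInv≡qbin*βqfall β q n k)) ,
  trans (InvGF.sumRlminInv≡qbin*βqfall β q n k) (sym (cong₂ _*_ (QNumbers.qbinom≡qbin β q k≤n) (QNumbers.βqprod≡βqfall β q k≤n)))
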